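{- Fix $k$ and $n$ with $0\le k\le n$. Let $\lambda$ be a partition with $\ell(\lambda)\le n$ and $|\lambda|\equiv0\pmod k$, put $m=|\lambda|/k$, and let $M$ be the $n\times m$ rectangle $(m,\dots,m)$ ($n$ parts). Then: (i) $a_{\lambda,k}=0$ unless $\lambda_1\le m$, in which case $a_{M\setminus\lambda,n-k}=a_{\lambda,k}$; (ii) $a'_{\lambda,k}=0$ unless $\lambda_1\le m$, in which case $a'_{M\setminus\lambda,n-k}=a'_{\lambda,k}$. Thus the coefficients $\{a_{\lambda,k}:\ell(\lambda)\le n\}$ for fixed $k$ determine the coefficients $\{a_{\lambda,n-k}:\ell(\lambda)\le n\}$. In particular, all coefficients $a_{\lambda,k}$ are determined (by the equality $a_{\lambda,j}=a'_{\lambda,j}$ valid for $j\le 2$) both when $k\le 2$ and when $\ell(\lambda)\le k+2$.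
   Context: A $k$-family is a finite collection of distinct $k$-subsets of $\mathbb{P}=\{1,2,\dots\}$, with degree sequence $d(K)=(d_1,d_2,\dots)$, $d_i=|\{S\in K:i\in S\}|$; it is shifted if down-closed in the componentwise order on $k$-sets ($\{x_1<\dots<x_k\}\le\{y_1<\dots<y_k\}$ iff $x_i\le y_i$ for all $i$). The plethysm coefficients $a_{\lambda,k}$ are defined by $\prod_{S\in\binom{\mathbb{P}}{k}}(1+\prod_{i\in S}x_i)=\sum_{m\ge0}e_m[e_k]=\sum_\lambda a_{\lambda,k}s_\lambda$ (Schur expansion), and $a'_{\lambda,k}$ is the number of shifted $k$-families $K$ with $d(K)=\lambda$. $\ell(\lambda)$ is the number of parts of $\lambda$. For $\lambda$ with $\ell(\lambda)\le n$, $\lambda_1\le m$, $M\setminus\lambda=(m-\lambda_n,m-\lambda_{n-1},\dots,m-\lambda_1)$. -}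

module Defs where

open import Data.Nat using (ℕ; zero; suc; _+_; _∸_; _≤?_; _<?_)
import Data.Nat as ℕ
open import Data.Bool using (Bool; true; false; _∧_; _∨_; not; if_then_else_)
import Data.Bool as B
open import Data.List using (List; []; _∷_; _++_; map; concatMap; length; foldr; filterᵇ; allFin)
open import Data.Bool.ListAction using (all; any)
open import Data.Vec using (Vec; []; _∷_; zipWith; replicate; reverse; tabulate; lookup)
import Data.Vec as V
open import Data.Vec.Properties using (≡-dec)
open import Data.Fin using (Fin; toℕ)
import Data.Fin as F
open import Data.Integer using (ℤ; +_; -_) renaming (_+_ to _+ℤ_; _*_ to _*ℤ_)
open import Data.Product using (_×_; _,_; proj₁; proj₂)
open import Relation.Nullary.Decidable using (⌊_⌋)

-- Partitions (padded with zeros to a fixed length n), so that a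
-- partition λ with ℓ(λ) ≤ n is a weakly decreasing Vec ℕ n.

IsPartition : {n : ℕ} → Vec ℕ n → Set
IsPartition {n} λ' = (i j : Fin n) → i F.≤ j → lookup λ' j ℕ.≤ lookup λ' i

first : {n : ℕ} → Vec ℕ n → ℕ
first []      = 0
first (x ∷ _) = x

complement : {n : ℕ} → ℕ → Vec ℕ n → Vec ℕ n
complement m λ' = reverse (V.map (m ∸_) λ')

-- Subsets of {1..N} (coordinate i ↔ element i+1) and k-families

Subset : ℕ → Set
Subset N = Vec Bool N

allSubsets : (N : ℕ) → List (Subset N)
allSubsets zero    = [] ∷ []
allSubsets (suc N) = map (true ∷_) (allSubsets N) ++ map (false ∷_) (allSubsets N)

size : {N : ℕ} → Subset N → ℕ
size []          = 0
size (true ∷ S)  = suc (size S)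
size (false ∷ S) = size S

kSubsets : (N k : ℕ) → List (Subset N)
kSubsets N k = filterᵇ (λ S → ⌊ size S ℕ.≟ k ⌋) (allSubsets N)

sublists : {A : Set} → List A → List (List A)
sublists []       = [] ∷ []
sublists (x ∷ xs) = map (x ∷_) (sublists xs) ++ sublists xs

families : (N k m : ℕ) → List (List (Subset N))
families N k m = filterᵇ (λ K → ⌊ length K ℕ.≟ m ⌋) (sublists (kSubsets N k))

indicator : {N : ℕ} → Subset N → Vec ℕ N
indicator = V.map (λ b → if b then 1 else 0)

-- degree sequence d(K) (restricted to 1..N); also the exponent
-- vector of the monomial ∏_{S∈K} ∏_{i∈S} x_i
degree : {N : ℕ} → List (Subset N) → Vec ℕ N
degree {N} []      = replicate N 0
degree     (S ∷ K) = zipWith _+_ (indicator S) (degree K)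

-- Polynomials in ℤ[x_1..x_N] as formal sums of terms (coeff, exponent)

Poly : ℕ → Set
Poly N = List (ℤ × Vec ℕ N)

_*P_ : {N : ℕ} → Poly N → Poly N → Poly N
p *P q = concatMap (λ t → map (λ u → (proj₁ t *ℤ proj₁ u , zipWith _+_ (proj₂ t) (proj₂ u))) q) p

oneP : {N : ℕ} → Poly N
oneP {N} = (+ 1 , replicate N 0) ∷ []

prodP : {N : ℕ} → List (Poly N) → Poly N
prodP = foldr _*P_ oneP

coeff : {N : ℕ} → Poly N → Vec ℕ N → ℤ
coeff p e = foldr _+ℤ_ (+ 0)
  (map proj₁ (filterᵇ (λ t → ⌊ ≡-dec ℕ._≟_ (proj₂ t) e ⌋) p))

unitVec : {N : ℕ} → Fin N → Vec ℕ N
unitVec i = tabulate (λ j → if ⌊ i F.≟ j ⌋ then 1 else 0)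

vandermonde : (N : ℕ) → Poly N
vandermonde N = prodP (concatMap (λ i → map (λ j → (+ 1 , unitVec i) ∷ (- (+ 1) , unitVec j) ∷ [])
                  (filterᵇ (λ j → ⌊ toℕ i <? toℕ j ⌋) (allFin N))) (allFin N))

delta : (N : ℕ) → Vec ℕ N
delta N = tabulate (λ i → N ∸ suc (toℕ i))

-- coefficient of s_λ in a symmetric polynomial f in N variables:
-- the coefficient of x^{λ+δ} in a_δ · f  (bialternant formula)
schurCoeff : {N : ℕ} → Poly N → Vec ℕ N → ℤ
schurCoeff {N} f λ' = coeff (vandermonde N *P f) (zipWith _+_ λ' (delta N))

-- the plethysm e_m[e_k] in x_1..x_N: e_m evaluated at the monomials of e_k,
-- i.e. the sum over m-element families K of k-subsets of ∏_{S∈K} x^S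
plethysm : (N k m : ℕ) → Poly N
plethysm N k m = map (λ K → (+ 1 , degree K)) (families N k m)

-- a_{λ,k} graded by m: coefficient of s_λ in e_m[e_k]
-- (computed in N = n ≥ ℓ(λ) variables)
a : {N : ℕ} → (k m : ℕ) → Vec ℕ N → ℤ
a {N} k m λ' = schurCoeff (plethysm N k m) λ'

elemsFrom : {N : ℕ} → ℕ → Subset N → List ℕ
elemsFrom i []          = []
elemsFrom i (true ∷ S)  = i ∷ elemsFrom (suc i) S
elemsFrom i (false ∷ S) = elemsFrom (suc i) S

elems : {N : ℕ} → Subset N → List ℕ
elems = elemsFrom 1

pointwiseLeq : List ℕ → List ℕ → Bool
pointwiseLeq []       []       = true
pointwiseLeq (x ∷ xs) (y ∷ ys) = ⌊ x ≤? y ⌋ ∧ pointwiseLeq xs ys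
pointwiseLeq _        _        = false

leqSet : {N : ℕ} → Subset N → Subset N → Bool
leqSet S T = pointwiseLeq (elems S) (elems T)

member : {N : ℕ} → Subset N → List (Subset N) → Bool
member S K = any (λ T → ⌊ ≡-dec B._≟_ S T ⌋) K

-- K is down-closed among k-subsets (sets below a subset of {1..N}
-- are themselves subsets of {1..N})
isShifted : {N : ℕ} → ℕ → List (Subset N) → Bool
isShifted {N} k K = all (λ S → all (λ T → not (leqSet T S) ∨ member T K) (kSubsets N k)) K

a' : {N : ℕ} → (k m : ℕ) → Vec ℕ N → ℕ
a' {N} k m λ' = length (filterᵇ (λ K → isShifted k K ∧ ⌊ ≡-dec ℕ._≟_ (degree K) λ' ⌋) (families N k m))

module Submission where

-- Write δ = (n−1, …, 0) and c = (n−1+m, …, n−1+m). By the bialternant formula a_{λ,k} is the coefficient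
-- of x^(λ+δ) in a_δ · e_m[e_k], a polynomial whose exponents are bounded by c. The substitution
-- x^e ↦ x^(reverse (c − e)) is multiplicative on such polynomials and preserves their coefficients. It
-- fixes a_δ, since it sends the factor x_i − x_j to x_(n+1−j) − x_(n+1−i), and it sends e_m[e_k] to
-- e_m[e_(n−k)], since it sends the monomial of a family K to the monomial of the family of duals
-- S ↦ {n+1−i : i ∉ S} of the members of K. As λ+δ goes to (M∖λ)+δ, part (i) follows, and λ₁ > m puts
-- λ+δ above the bound c. The duality is monotone for the componentwise order, so it also matches the
-- shifted families counted by a'_{λ,k} with those counted by a'_{M∖λ,n−k}, which gives part (ii).

open import Defs
open import Data.Nat as ℕ using (ℕ; zero; suc; _+_; _*_; _∸_; _≤_; _<_; z≤n; s≤s)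
open import Data.Vec as Vec using (Vec; sum; []; _∷_; replicate; reverse; zipWith; lookup)
open import Data.Integer as ℤ using (ℤ; +_; -_)
open import Data.Product using (_×_; _,_; proj₁; proj₂)
open import Relation.Binary.PropositionalEquality as ≡
  using (_≡_; _≢_; refl; sym; trans; cong; cong₂; subst; subst₂; module ≡-Reasoning)

open import Algebra.Core using (Op₂)
open import Algebra.Structures using (IsCommutativeMonoid)
open import Data.Bool as Bool using (Bool; true; false; _∧_; _∨_; not; T)
import Data.Bool.Properties as Boolₚ
open import Data.Bool.ListAction using (and; or; all; any)
open import Data.Empty using (⊥)
open import Data.Fin as Fin using (Fin; toℕ; opposite)
import Data.Fin.Properties as Finₚ
import Data.Integer.Properties as ℤₚ
import Algebra.Properties.CommutativeSemigroup ℤₚ.*-commutativeSemigroup as ℤ*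
open import Data.List as List using (List; []; _∷_; _++_; concatMap; filterᵇ; length; foldr; allFin)
import Data.List.Properties as Listₚ
open import Data.List.Membership.Propositional using (_∈_)
import Data.List.Membership.Propositional.Properties as ∈ₚ
open import Data.List.Membership.Propositional.Properties.WithK using (unique∧set⇒bag)
open import Data.List.Relation.Binary.BagAndSetEquality using (∼bag⇒↭)
open import Data.List.Relation.Binary.Permutation.Propositional as ↭
  using (_↭_; ↭-refl; ↭-sym; ↭-trans; ↭-reflexive; prep; swap; ↭⇒↭ₛ; ↭ₛ⇒↭; ↭-setoid)
import Data.List.Relation.Binary.Permutation.Propositional.Properties as ↭ₚ
import Data.List.Relation.Binary.Permutation.Setoid as PermutationSetoid
import Data.List.Relation.Binary.Permutation.Setoid.Properties as PermutationSetoidₚ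
import Data.List.Relation.Binary.Pointwise as ListPointwise
open import Data.List.Relation.Unary.All as All using (All; []; _∷_)
import Data.List.Relation.Unary.All.Properties as Allₚ
import Data.List.Relation.Unary.AllPairs as AllPairs
import Data.List.Relation.Unary.Any as Any
open import Data.List.Relation.Unary.Unique.Propositional using (Unique)
import Data.List.Relation.Unary.Unique.Propositional.Properties as Uniqueₚ
open import Data.Maybe using (Maybe; just; nothing; _>>=_)
import Data.Nat.Properties as ℕₚ
open import Data.Sum using (inj₁; inj₂)
import Data.Vec.Properties as Vecₚ
open import Data.Vec.Properties using (≡-dec)
open import Data.Vec.Relation.Binary.Pointwise.Inductive as Pointwise using (Pointwise; []; _∷_)
open import Function using (id; _∘_; _⇔_; mk⇔; Equivalence)
open import Relation.Nullary using (Dec; ¬_)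
open import Relation.Nullary.Decidable as Dec using (⌊_⌋)

private variable
  A B C : Set
  n : ℕ

⌊⌋-⇔ : {P Q : Set} → P ⇔ Q → (p : Dec P) (q : Dec Q) → ⌊ p ⌋ ≡ ⌊ q ⌋
⌊⌋-⇔ P⇔Q p q = trans (Dec.isYes≗does p) (trans (Dec.does-⇔ P⇔Q p q) (sym (Dec.isYes≗does q)))

⌊⌋-true : {P : Set} (p : Dec P) → P → ⌊ p ⌋ ≡ true
⌊⌋-true p x = trans (Dec.isYes≗does p) (Dec.dec-true p x)

⌊⌋-false : {P : Set} (p : Dec P) → ¬ P → ⌊ p ⌋ ≡ false
⌊⌋-false p ¬x = trans (Dec.isYes≗does p) (Dec.dec-false p ¬x)

foldr-↭ : {_∙_ : Op₂ A} {ε : A} → IsCommutativeMonoid _≡_ _∙_ ε →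
          {xs ys : List A} → xs ↭ ys → foldr _∙_ ε xs ≡ foldr _∙_ ε ys
foldr-↭ {A} isCM p = PermutationSetoidₚ.foldr-commMonoid (≡.setoid A) isCM (↭⇒↭ₛ p)

all-↭ : (f : A → Bool) {xs ys : List A} → xs ↭ ys → all f xs ≡ all f ys
all-↭ f p = foldr-↭ Boolₚ.∧-isCommutativeMonoid (↭ₚ.map⁺ f p)

any-↭ : (f : A → Bool) {xs ys : List A} → xs ↭ ys → any f xs ≡ any f ys
any-↭ f p = foldr-↭ Boolₚ.∨-isCommutativeMonoid (↭ₚ.map⁺ f p)

concatMap⁺ : (f : A → List B) {xs ys : List A} → xs ↭ ys → concatMap f xs ↭ concatMap f ys
concatMap⁺ f ↭.refl          = ↭-refl
concatMap⁺ f (prep x p)      = ↭ₚ.++⁺ˡ (f x) (concatMap⁺ f p)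
concatMap⁺ f (swap x y p)    =
  ↭-trans (↭ₚ.shifts (f x) (f y)) (↭ₚ.++⁺ˡ (f y) (↭ₚ.++⁺ˡ (f x) (concatMap⁺ f p)))
concatMap⁺ f (↭.trans p q)   = ↭-trans (concatMap⁺ f p) (concatMap⁺ f q)

concatMap-cong-↭ : {f g : A → List B} (xs : List A) → (∀ x → f x ↭ g x) →
                   concatMap f xs ↭ concatMap g xs
concatMap-cong-↭ []       f↭g = ↭-refl
concatMap-cong-↭ (x ∷ xs) f↭g = ↭ₚ.++⁺ (f↭g x) (concatMap-cong-↭ xs f↭g)

concatMap-++-↭ : (f g : A → List B) (xs : List A) →
                 concatMap (λ x → f x ++ g x) xs ↭ concatMap f xs ++ concatMap g xs
concatMap-++-↭ f g []       = ↭-refl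
concatMap-++-↭ f g (x ∷ xs) = begin
  (f x ++ g x) ++ concatMap (λ x → f x ++ g x) xs   ↭⟨ ↭ₚ.++⁺ˡ (f x ++ g x) (concatMap-++-↭ f g xs) ⟩
  (f x ++ g x) ++ (concatMap f xs ++ concatMap g xs) ≡⟨ Listₚ.++-assoc (f x) (g x) _ ⟩
  f x ++ (g x ++ concatMap f xs ++ concatMap g xs)   ↭⟨ ↭ₚ.++⁺ˡ (f x) (↭ₚ.shifts (g x) (concatMap f xs)) ⟩
  f x ++ (concatMap f xs ++ g x ++ concatMap g xs)   ≡⟨ Listₚ.++-assoc (f x) (concatMap f xs) _ ⟨
  (f x ++ concatMap f xs) ++ (g x ++ concatMap g xs) ∎
  where open ↭.PermutationReasoning

concatMap-comm : (f : A → B → List C) (xs : List A) (ys : List B) →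
  concatMap (λ x → concatMap (f x) ys) xs ↭ concatMap (λ y → concatMap (λ x → f x y) xs) ys
concatMap-comm f []       ys = ↭-reflexive (sym (concatMap-[] ys))
  where
  concatMap-[] : (ys : List B) → concatMap (λ _ → []) ys ≡ []
  concatMap-[] []       = refl
  concatMap-[] (y ∷ ys) = concatMap-[] ys
concatMap-comm f (x ∷ xs) ys =
  ↭-trans (↭ₚ.++⁺ˡ (concatMap (f x) ys) (concatMap-comm f xs ys))
          (↭-sym (concatMap-++-↭ (f x) (λ y → concatMap (λ x′ → f x′ y) xs) ys))

filterᵇ-map : (p : B → Bool) (q : A → Bool) (f : A → B) {xs : List A} →
              All (λ x → p (f x) ≡ q x) xs → filterᵇ p (List.map f xs) ≡ List.map f (filterᵇ q xs)
filterᵇ-map p q f []                    = refl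
filterᵇ-map p q f {x ∷ _} (eq ∷ eqs) rewrite eq with q x
... | true  = cong (f x ∷_) (filterᵇ-map p q f eqs)
... | false = filterᵇ-map p q f eqs

map-involution-↭ : (f : A → A) → (∀ x → f (f x) ≡ x) → {xs ys : List A} → Unique xs → Unique ys →
                   (∀ {x} → x ∈ xs → f x ∈ ys) → (∀ {y} → y ∈ ys → f y ∈ xs) → List.map f xs ↭ ys
map-involution-↭ f f∘f≡id {xs} {ys} !xs !ys f[xs]⊆ys f[ys]⊆xs =
  ∼bag⇒↭ (unique∧set⇒bag (Uniqueₚ.map⁺ f-injective !xs) !ys (mk⇔ to from))
  where
  f-injective : ∀ {x y} → f x ≡ f y → x ≡ y
  f-injective {x} {y} eq = trans (sym (f∘f≡id x)) (trans (cong f eq) (f∘f≡id y))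
  to : ∀ {y} → y ∈ List.map f xs → y ∈ ys
  to y∈ with ∈ₚ.∈-map⁻ f y∈
  ... | x , x∈xs , refl = f[xs]⊆ys x∈xs
  from : ∀ {y} → y ∈ ys → y ∈ List.map f xs
  from {y} y∈ys = subst (_∈ List.map f xs) (f∘f≡id y) (∈ₚ.∈-map⁺ f (f[ys]⊆xs y∈ys))

infixl 6 _+ᵛ_
_+ᵛ_ : Vec ℕ n → Vec ℕ n → Vec ℕ n
_+ᵛ_ = zipWith _+_

infix 4 _≤ᵛ_
_≤ᵛ_ : Vec ℕ n → Vec ℕ n → Set
_≤ᵛ_ = Pointwise _≤_

+ᵛ-comm : (x y : Vec ℕ n) → x +ᵛ y ≡ y +ᵛ x
+ᵛ-comm = Vecₚ.zipWith-comm ℕₚ.+-comm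

+ᵛ-assoc : (x y z : Vec ℕ n) → (x +ᵛ y) +ᵛ z ≡ x +ᵛ (y +ᵛ z)
+ᵛ-assoc = Vecₚ.zipWith-assoc ℕₚ.+-assoc

+ᵛ-identityˡ : (x : Vec ℕ n) → replicate n 0 +ᵛ x ≡ x
+ᵛ-identityˡ = Vecₚ.zipWith-identityˡ ℕₚ.+-identityˡ

+ᵛ-lcomm : (x y z : Vec ℕ n) → x +ᵛ (y +ᵛ z) ≡ y +ᵛ (x +ᵛ z)
+ᵛ-lcomm x y z = begin
  x +ᵛ (y +ᵛ z) ≡⟨ +ᵛ-assoc x y z ⟨
  (x +ᵛ y) +ᵛ z ≡⟨ cong (_+ᵛ z) (+ᵛ-comm x y) ⟩
  (y +ᵛ x) +ᵛ z ≡⟨ +ᵛ-assoc y x z ⟩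
  y +ᵛ (x +ᵛ z) ∎
  where open ≡-Reasoning

≤ᵛ-refl : {x : Vec ℕ n} → x ≤ᵛ x
≤ᵛ-refl = Pointwise.refl ℕₚ.≤-refl

+ᵛ-mono-≤ᵛ : {x y u v : Vec ℕ n} → x ≤ᵛ u → y ≤ᵛ v → x +ᵛ y ≤ᵛ u +ᵛ v
+ᵛ-mono-≤ᵛ = Pointwise.zipWith-cong ℕₚ.+-mono-≤

x≤ᵛx+ᵛy : (x y : Vec ℕ n) → x ≤ᵛ x +ᵛ y
x≤ᵛx+ᵛy []      []      = []
x≤ᵛx+ᵛy (a ∷ x) (b ∷ y) = ℕₚ.m≤m+n a b ∷ x≤ᵛx+ᵛy x y

y≤ᵛx+ᵛy : (x y : Vec ℕ n) → y ≤ᵛ x +ᵛ y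
y≤ᵛx+ᵛy []      []      = []
y≤ᵛx+ᵛy (a ∷ x) (b ∷ y) = ℕₚ.m≤n+m b a ∷ y≤ᵛx+ᵛy x y

≤ᵛ-lookup⁺ : (x y : Vec ℕ n) → (∀ i → lookup x i ≤ lookup y i) → x ≤ᵛ y
≤ᵛ-lookup⁺ []      []      _ = []
≤ᵛ-lookup⁺ (a ∷ x) (b ∷ y) h = h Fin.zero ∷ ≤ᵛ-lookup⁺ x y (h ∘ Fin.suc)

lookup-ext : {x y : Vec A n} → (∀ i → lookup x i ≡ lookup y i) → x ≡ y
lookup-ext {x = x} {y} h =
  trans (sym (Vecₚ.tabulate∘lookup x)) (trans (Vecₚ.tabulate-cong h) (Vecₚ.tabulate∘lookup y))

lookup-reverse : (xs : Vec A n) (i : Fin n) → lookup (reverse xs) i ≡ lookup xs (opposite i)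
lookup-reverse xs i =
  trans (cong (lookup (reverse xs)) (sym (Finₚ.opposite-involutive i))) (lookup-reverse-opposite xs (opposite i))
  where
  lookup-∷ʳ-last : (xs : Vec A n) (x : A) → lookup (xs Vec.∷ʳ x) (Fin.fromℕ n) ≡ x
  lookup-∷ʳ-last []       x = refl
  lookup-∷ʳ-last (y ∷ xs) x = lookup-∷ʳ-last xs x
  lookup-∷ʳ-inject₁ : (xs : Vec A n) (x : A) (i : Fin n) → lookup (xs Vec.∷ʳ x) (Fin.inject₁ i) ≡ lookup xs i
  lookup-∷ʳ-inject₁ (y ∷ xs) x Fin.zero    = refl
  lookup-∷ʳ-inject₁ (y ∷ xs) x (Fin.suc i) = lookup-∷ʳ-inject₁ xs x i
  lookup-reverse-opposite : (xs : Vec A n) (i : Fin n) → lookup (reverse xs) (opposite i) ≡ lookup xs i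
  lookup-reverse-opposite (x ∷ xs) i rewrite Vecₚ.reverse-∷ x xs with i
  ... | Fin.zero  = lookup-∷ʳ-last (reverse xs) x
  ... | Fin.suc i = trans (lookup-∷ʳ-inject₁ (reverse xs) x (opposite i)) (lookup-reverse-opposite xs i)

reverse-replicate : (x : A) → reverse (replicate n x) ≡ replicate n x
reverse-replicate x = lookup-ext λ i →
  trans (lookup-reverse (replicate _ x) i) (trans (Vecₚ.lookup-replicate (opposite i) x) (sym (Vecₚ.lookup-replicate i x)))

zipWith-reverse : (f : A → B → C) (xs : Vec A n) (ys : Vec B n) →
                  zipWith f (reverse xs) (reverse ys) ≡ reverse (zipWith f xs ys)
zipWith-reverse f xs ys = lookup-ext λ i → begin
  lookup (zipWith f (reverse xs) (reverse ys)) i            ≡⟨ Vecₚ.lookup-zipWith f i (reverse xs) (reverse ys) ⟩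
  f (lookup (reverse xs) i) (lookup (reverse ys) i)         ≡⟨ cong₂ f (lookup-reverse xs i) (lookup-reverse ys i) ⟩
  f (lookup xs (opposite i)) (lookup ys (opposite i))       ≡⟨ Vecₚ.lookup-zipWith f (opposite i) xs ys ⟨
  lookup (zipWith f xs ys) (opposite i)                     ≡⟨ lookup-reverse (zipWith f xs ys) i ⟨
  lookup (reverse (zipWith f xs ys)) i                      ∎
  where open ≡-Reasoning

[m+n]∸[o+p]≡[m∸o]+[n∸p] : (m n o p : ℕ) → o ≤ m → p ≤ n → (m + n) ∸ (o + p) ≡ (m ∸ o) + (n ∸ p)
[m+n]∸[o+p]≡[m∸o]+[n∸p] m n o p o≤m p≤n = begin
  (m + n) ∸ (o + p)   ≡⟨ ℕₚ.∸-+-assoc (m + n) o p ⟨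
  (m + n) ∸ o ∸ p     ≡⟨ cong (_∸ p) (ℕₚ.+-∸-comm n o≤m) ⟩
  (m ∸ o + n) ∸ p     ≡⟨ ℕₚ.+-∸-assoc (m ∸ o) p≤n ⟩
  (m ∸ o) + (n ∸ p)   ∎
  where open ≡-Reasoning

zipWith-∸-+ᵛ : {c d e f : Vec ℕ n} → e ≤ᵛ c → f ≤ᵛ d →
               zipWith _∸_ (c +ᵛ d) (e +ᵛ f) ≡ zipWith _∸_ c e +ᵛ zipWith _∸_ d f
zipWith-∸-+ᵛ []                           []                  = refl
zipWith-∸-+ᵛ {c = a ∷ _} {b ∷ _} {x ∷ _} {y ∷ _} (x≤a ∷ e≤c) (y≤b ∷ f≤d) =
  cong₂ _∷_ ([m+n]∸[o+p]≡[m∸o]+[n∸p] a b x y x≤a y≤b) (zipWith-∸-+ᵛ e≤c f≤d)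

zipWith-∸-cancelˡ : {c e f : Vec ℕ n} → e ≤ᵛ c → f ≤ᵛ c → zipWith _∸_ c e ≡ zipWith _∸_ c f → e ≡ f
zipWith-∸-cancelˡ []          []          _  = refl
zipWith-∸-cancelˡ (x≤a ∷ e≤c) (y≤a ∷ f≤c) eq =
  cong₂ _∷_ (ℕₚ.∸-cancelˡ-≡ x≤a y≤a (Vecₚ.∷-injectiveˡ eq))
            (zipWith-∸-cancelˡ e≤c f≤c (Vecₚ.∷-injectiveʳ eq))

-- Polynomials as lists of terms, up to reordering

Term : ℕ → Set
Term n = ℤ × Vec ℕ n

_*ᵗ_ : Term n → Term n → Term n
t *ᵗ u = (proj₁ t ℤ.* proj₁ u , proj₂ t +ᵛ proj₂ u)

*ᵗ-lcomm : (t u v : Term n) → t *ᵗ (u *ᵗ v) ≡ u *ᵗ (t *ᵗ v)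
*ᵗ-lcomm (a , x) (b , y) (c , z) = cong₂ _,_ (ℤ*.x∙yz≈y∙xz a b c) (+ᵛ-lcomm x y z)

*P-lcomm : (p q r : Poly n) → p *P (q *P r) ↭ q *P (p *P r)
*P-lcomm p q r = begin
  p *P (q *P r)                                                            ≡⟨ expand p q ⟩
  concatMap (λ t → concatMap (λ u → List.map (λ v → t *ᵗ (u *ᵗ v)) r) q) p ↭⟨ concatMap-comm _ p q ⟩
  concatMap (λ u → concatMap (λ t → List.map (λ v → t *ᵗ (u *ᵗ v)) r) p) q
    ≡⟨ Listₚ.concatMap-cong (λ u → Listₚ.concatMap-cong (λ t → Listₚ.map-cong (*ᵗ-lcomm t u) r) p) q ⟩
  concatMap (λ u → concatMap (λ t → List.map (λ v → u *ᵗ (t *ᵗ v)) r) p) q ≡⟨ expand q p ⟨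
  q *P (p *P r)                                                            ∎
  where
  open ↭.PermutationReasoning
  expand : (p q : Poly _) → p *P (q *P r) ≡ concatMap (λ t → concatMap (λ u → List.map (λ v → t *ᵗ (u *ᵗ v)) r) q) p
  expand p q = Listₚ.concatMap-cong (λ t →
    trans (Listₚ.map-concatMap (t *ᵗ_) (λ u → List.map (u *ᵗ_) r) q)
          (Listₚ.concatMap-cong (λ u → sym (Listₚ.map-∘ r)) q)) p

*P-congˡ : {p p′ : Poly n} (q : Poly n) → p ↭ p′ → p *P q ↭ p′ *P q
*P-congˡ q = concatMap⁺ (λ t → List.map (t *ᵗ_) q)

*P-congʳ : (p : Poly n) {q q′ : Poly n} → q ↭ q′ → p *P q ↭ p *P q′
*P-congʳ p q↭q′ = concatMap-cong-↭ p (λ t → ↭ₚ.map⁺ (t *ᵗ_) q↭q′)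

*P-cong : {p p′ q q′ : Poly n} → p ↭ p′ → q ↭ q′ → p *P q ↭ p′ *P q′
*P-cong {p′ = p′} {q} p↭p′ q↭q′ = ↭-trans (*P-congˡ q p↭p′) (*P-congʳ p′ q↭q′)

prodP-↭ : {ps qs : List (Poly n)} → ps ↭ qs → prodP ps ↭ prodP qs
prodP-↭ ↭.refl                         = ↭-refl
prodP-↭ (prep p ps↭qs)                 = *P-congʳ p (prodP-↭ ps↭qs)
prodP-↭ {ps = p ∷ q ∷ ps} (swap _ _ ps↭qs) =
  ↭-trans (*P-lcomm p q (prodP ps)) (*P-congʳ q (*P-congʳ p (prodP-↭ ps↭qs)))
prodP-↭ (↭.trans ps↭qs qs↭rs)          = ↭-trans (prodP-↭ ps↭qs) (prodP-↭ qs↭rs)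

hasExponent : Vec ℕ n → Term n → Bool
hasExponent e t = ⌊ ≡-dec ℕ._≟_ (proj₂ t) e ⌋

coeff-↭ : {p q : Poly n} (e : Vec ℕ n) → p ↭ q → coeff p e ≡ coeff q e
coeff-↭ e p↭q = foldr-↭ ℤₚ.+-0-isCommutativeMonoid (↭ₚ.map⁺ proj₁ (↭ₚ.filter-↭ (Bool.T? ∘ hasExponent e) p↭q))

coeff-absent : (p : Poly n) (e : Vec ℕ n) → All (λ t → proj₂ t ≢ e) p → coeff p e ≡ + 0
coeff-absent p e none = cong (foldr ℤ._+_ (+ 0) ∘ List.map proj₁) (Listₚ.filter-none (Bool.T? ∘ hasExponent e)
  (All.map (λ {t} t≢e → t≢e ∘ Dec.toWitness {a? = ≡-dec ℕ._≟_ (proj₂ t) e}) none))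

BoundedBy : Vec ℕ n → Poly n → Set
BoundedBy c = All (λ t → proj₂ t ≤ᵛ c)

coeff-unbounded : {c e : Vec ℕ n} (p : Poly n) → BoundedBy c p → ¬ (e ≤ᵛ c) → coeff p e ≡ + 0
coeff-unbounded {e = e} p p≤c e≰c = coeff-absent p e (All.map (λ t≤c t≡e → e≰c (subst (_≤ᵛ _) t≡e t≤c)) p≤c)

*P-bounded : {c d : Vec ℕ n} {p q : Poly n} → BoundedBy c p → BoundedBy d q → BoundedBy (c +ᵛ d) (p *P q)
*P-bounded {p = []}    []          q≤d = []
*P-bounded {c = c} {d} {t ∷ _} (t≤c ∷ p≤c) q≤d = Allₚ.++⁺ (times q≤d) (*P-bounded p≤c q≤d)
  where
  times : ∀ {q} → BoundedBy d q → BoundedBy (c +ᵛ d) (List.map (t *ᵗ_) q)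
  times []          = []
  times (u≤d ∷ q≤d) = +ᵛ-mono-≤ᵛ t≤c u≤d ∷ times q≤d

-- The reflection x^e ↦ x^(reverse (c ∸ e)) of polynomials with exponents bounded by c

reflect : Vec ℕ n → Vec ℕ n → Vec ℕ n
reflect c e = reverse (zipWith _∸_ c e)

reflectᵗ : Vec ℕ n → Term n → Term n
reflectᵗ c t = (proj₁ t , reflect c (proj₂ t))

reflectP : Vec ℕ n → Poly n → Poly n
reflectP c = List.map (reflectᵗ c)

reflect-injective : {c e f : Vec ℕ n} → e ≤ᵛ c → f ≤ᵛ c → reflect c e ≡ reflect c f → e ≡ f
reflect-injective e≤c f≤c eq = zipWith-∸-cancelˡ e≤c f≤c (Vecₚ.reverse-injective eq)

reflect-+ᵛ : {c d e f : Vec ℕ n} → e ≤ᵛ c → f ≤ᵛ d → reflect (c +ᵛ d) (e +ᵛ f) ≡ reflect c e +ᵛ reflect d f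
reflect-+ᵛ {c = c} {d} {e} {f} e≤c f≤d =
  trans (cong reverse (zipWith-∸-+ᵛ e≤c f≤d)) (sym (zipWith-reverse _+_ (zipWith _∸_ c e) (zipWith _∸_ d f)))

coeff-reflectP : {c e : Vec ℕ n} (p : Poly n) → BoundedBy c p → e ≤ᵛ c →
                 coeff (reflectP c p) (reflect c e) ≡ coeff p e
coeff-reflectP {c = c} {e} p p≤c e≤c = cong (foldr ℤ._+_ (+ 0)) (begin
  List.map proj₁ (filterᵇ (hasExponent (reflect c e)) (reflectP c p))    ≡⟨ cong (List.map proj₁) filter-reflect ⟩
  List.map proj₁ (reflectP c (filterᵇ (hasExponent e) p))                ≡⟨ Listₚ.map-∘ (filterᵇ (hasExponent e) p) ⟨
  List.map proj₁ (filterᵇ (hasExponent e) p)                             ∎)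
  where
  open ≡-Reasoning
  filter-reflect : filterᵇ (hasExponent (reflect c e)) (reflectP c p) ≡ reflectP c (filterᵇ (hasExponent e) p)
  filter-reflect = filterᵇ-map (hasExponent (reflect c e)) (hasExponent e) (reflectᵗ c)
    (All.map (λ t≤c → ⌊⌋-⇔ (mk⇔ (reflect-injective t≤c e≤c) (cong (reflect c))) _ _) p≤c)

reflectP-*P : {c d : Vec ℕ n} {p q : Poly n} → BoundedBy c p → BoundedBy d q →
              reflectP (c +ᵛ d) (p *P q) ≡ reflectP c p *P reflectP d q
reflectP-*P {p = []}    []          q≤d = refl
reflectP-*P {c = c} {d} {t ∷ p} {q} (t≤c ∷ p≤c) q≤d =
  trans (Listₚ.map-++ (reflectᵗ (c +ᵛ d)) (List.map (t *ᵗ_) q) (p *P q))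
        (cong₂ _++_ (times q≤d) (reflectP-*P p≤c q≤d))
  where
  times : ∀ {q} → BoundedBy d q → reflectP (c +ᵛ d) (List.map (t *ᵗ_) q) ≡ List.map (reflectᵗ c t *ᵗ_) (reflectP d q)
  times []          = refl
  times (u≤d ∷ q≤d) = cong₂ _∷_ (cong (proj₁ t ℤ.* _ ,_) (reflect-+ᵛ t≤c u≤d)) (times q≤d)

-- The Vandermonde product a_δ

bit : Bool → ℕ
bit b = Bool.if b then 1 else 0

unitVec-zero : unitVec {suc n} Fin.zero ≡ 1 ∷ replicate n 0
unitVec-zero = cong (1 ∷_) (lookup-ext λ i → trans (Vecₚ.lookup∘tabulate _ i) (sym (Vecₚ.lookup-replicate i 0)))

unitVec-suc : (i : Fin n) → unitVec (Fin.suc i) ≡ 0 ∷ unitVec i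
unitVec-suc i = cong (0 ∷_) (Vecₚ.tabulate-cong λ j →
  cong bit (Dec.⌊⌋-map′ (cong Fin.suc) Finₚ.suc-injective (i Fin.≟ j)))

reverse-unitVec : (i : Fin n) → reverse (unitVec i) ≡ unitVec (opposite i)
reverse-unitVec i = lookup-ext λ j → begin
  lookup (reverse (unitVec i)) j          ≡⟨ lookup-reverse (unitVec i) j ⟩
  lookup (unitVec i) (opposite j)         ≡⟨ Vecₚ.lookup∘tabulate _ (opposite j) ⟩
  bit ⌊ i Fin.≟ opposite j ⌋              ≡⟨ cong bit (⌊⌋-⇔ (mk⇔ opposite-swap opposite-swap′) _ _) ⟩
  bit ⌊ opposite i Fin.≟ j ⌋              ≡⟨ Vecₚ.lookup∘tabulate _ j ⟨
  lookup (unitVec (opposite i)) j         ∎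
  where
  open ≡-Reasoning
  opposite-swap : {i j : Fin n} → i ≡ opposite j → opposite i ≡ j
  opposite-swap {j = j} refl = Finₚ.opposite-involutive j
  opposite-swap′ : {i j : Fin n} → opposite i ≡ j → i ≡ opposite j
  opposite-swap′ {i = i} refl = sym (Finₚ.opposite-involutive i)

factor : Fin n × Fin n → Poly n
factor (i , j) = (+ 1 , unitVec i) ∷ (- (+ 1) , unitVec j) ∷ []

factorDegree : Fin n × Fin n → Vec ℕ n
factorDegree (i , j) = unitVec i +ᵛ unitVec j

flipPair : Fin n × Fin n → Fin n × Fin n
flipPair (i , j) = (opposite j , opposite i)

sumᵛ : List (Vec ℕ n) → Vec ℕ n
sumᵛ = foldr _+ᵛ_ (replicate _ 0)

factor-bounded : (p : Fin n × Fin n) → BoundedBy (factorDegree p) (factor p)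
factor-bounded (i , j) = x≤ᵛx+ᵛy (unitVec i) (unitVec j) ∷ y≤ᵛx+ᵛy (unitVec i) (unitVec j) ∷ []

reflectP-factor : (p : Fin n × Fin n) → reflectP (factorDegree p) (factor p) ≡ factor (flipPair p)
reflectP-factor (i , j) =
  cong₂ _∷_ (cong (+ 1 ,_) (trans (cong reverse (x+y∸x≡y (unitVec i) (unitVec j))) (reverse-unitVec j)))
  (cong₂ _∷_ (cong (- (+ 1) ,_) (trans (cong reverse (x+y∸y≡x (unitVec i) (unitVec j))) (reverse-unitVec i))) refl)
  where
  x+y∸x≡y : (x y : Vec ℕ n) → zipWith _∸_ (x +ᵛ y) x ≡ y
  x+y∸x≡y []      []      = refl
  x+y∸x≡y (a ∷ x) (b ∷ y) = cong₂ _∷_ (ℕₚ.m+n∸m≡n a b) (x+y∸x≡y x y)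
  x+y∸y≡x : (x y : Vec ℕ n) → zipWith _∸_ (x +ᵛ y) y ≡ x
  x+y∸y≡x []      []      = refl
  x+y∸y≡x (a ∷ x) (b ∷ y) = cong₂ _∷_ (ℕₚ.m+n∸n≡m a b) (x+y∸y≡x x y)

prodP-factors-bounded : (ps : List (Fin n × Fin n)) →
                        BoundedBy (sumᵛ (List.map factorDegree ps)) (prodP (List.map factor ps))
prodP-factors-bounded []       = ≤ᵛ-refl ∷ []
prodP-factors-bounded (p ∷ ps) = *P-bounded (factor-bounded p) (prodP-factors-bounded ps)

reflectP-prodP-factors : (ps : List (Fin n × Fin n)) →
  reflectP (sumᵛ (List.map factorDegree ps)) (prodP (List.map factor ps)) ≡ prodP (List.map (factor ∘ flipPair) ps)
reflectP-prodP-factors []       = cong (λ e → (+ 1 , e) ∷ [])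
  (trans (cong reverse (Vecₚ.zipWith-replicate _∸_ 0 0)) (reverse-replicate 0))
reflectP-prodP-factors (p ∷ ps) =
  trans (reflectP-*P (factor-bounded p) (prodP-factors-bounded ps))
        (cong₂ _*P_ (reflectP-factor p) (reflectP-prodP-factors ps))

allFin-suc : (n : ℕ) → allFin (suc n) ≡ Fin.zero ∷ List.map Fin.suc (allFin n)
allFin-suc n = cong (Fin.zero ∷_) (sym (Listₚ.map-tabulate id Fin.suc))

below : Fin n → Fin n → Bool
below i j = ⌊ toℕ i ℕ.<? toℕ j ⌋

below-suc : (i j : Fin n) → below (Fin.suc i) (Fin.suc j) ≡ below i j
below-suc i j = ⌊⌋-⇔ (mk⇔ ℕ.s≤s⁻¹ s≤s) _ _

pairs : (n : ℕ) → List (Fin n × Fin n)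
pairs n = concatMap (λ i → List.map (i ,_) (filterᵇ (below i) (allFin n))) (allFin n)

vandermonde-pairs : (n : ℕ) → vandermonde n ≡ prodP (List.map factor (pairs n))
vandermonde-pairs n = cong prodP (sym (trans
  (Listₚ.map-concatMap factor (λ i → List.map (i ,_) (filterᵇ (below i) (allFin n))) (allFin n))
  (Listₚ.concatMap-cong (λ i → sym (Listₚ.map-∘ (filterᵇ (below i) (allFin n)))) (allFin n))))

sucPair : Fin n × Fin n → Fin (suc n) × Fin (suc n)
sucPair (i , j) = (Fin.suc i , Fin.suc j)

firstRow : (n : ℕ) → List (Fin (suc n) × Fin (suc n))
firstRow n = List.map (λ j → Fin.zero , Fin.suc j) (allFin n)

pairs-suc : (n : ℕ) → pairs (suc n) ≡ firstRow n ++ List.map sucPair (pairs n)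
pairs-suc n = begin
  pairs (suc n)
    ≡⟨ cong (λ is → concatMap (row is) is) (allFin-suc n) ⟩
  row is Fin.zero ++ concatMap (row is) (List.map Fin.suc js)
    ≡⟨ cong₂ _++_ first-row (Listₚ.concatMap-map (row is) Fin.suc js) ⟩
  firstRow n ++ concatMap (row is ∘ Fin.suc) js
    ≡⟨ cong (firstRow n ++_) (Listₚ.concatMap-cong later-row js) ⟩
  firstRow n ++ concatMap (List.map sucPair ∘ row js) js
    ≡⟨ cong (firstRow n ++_) (Listₚ.map-concatMap sucPair (row js) js) ⟨
  firstRow n ++ List.map sucPair (pairs n) ∎
  where
  open ≡-Reasoning
  js : List (Fin n)
  js = allFin n
  is : List (Fin (suc n))
  is = Fin.zero ∷ List.map Fin.suc js
  row : ∀ {m} → List (Fin m) → Fin m → List (Fin m × Fin m)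
  row ks i = List.map (i ,_) (filterᵇ (below i) ks)
  first-row : row is Fin.zero ≡ firstRow n
  first-row = begin
    List.map (Fin.zero ,_) (filterᵇ (below Fin.zero) (List.map Fin.suc js))
      ≡⟨ cong (List.map (Fin.zero ,_)) (filterᵇ-map (below Fin.zero) (λ _ → true) Fin.suc (All.universal (λ _ → refl) js)) ⟩
    List.map (Fin.zero ,_) (List.map Fin.suc (filterᵇ (λ _ → true) js))
      ≡⟨ cong (List.map (Fin.zero ,_) ∘ List.map Fin.suc) (Listₚ.filter-all (Bool.T? ∘ λ _ → true) (All.universal _ js)) ⟩
    List.map (Fin.zero ,_) (List.map Fin.suc js)
      ≡⟨ Listₚ.map-∘ js ⟨
    firstRow n ∎
  later-row : (i : Fin n) → row is (Fin.suc i) ≡ List.map sucPair (row js i)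
  later-row i = begin
    List.map (Fin.suc i ,_) (filterᵇ (below (Fin.suc i)) (List.map Fin.suc js))
      ≡⟨ cong (List.map (Fin.suc i ,_)) (filterᵇ-map (below (Fin.suc i)) (below i) Fin.suc (All.universal (below-suc i) js)) ⟩
    List.map (Fin.suc i ,_) (List.map Fin.suc (filterᵇ (below i) js))
      ≡⟨ Listₚ.map-∘ (filterᵇ (below i) js) ⟨
    List.map (λ j → Fin.suc i , Fin.suc j) (filterᵇ (below i) js)
      ≡⟨ Listₚ.map-∘ (filterᵇ (below i) js) ⟩
    List.map sucPair (row js i) ∎

pairs-unique : (n : ℕ) → Unique (pairs n)
pairs-unique zero    = AllPairs.[]
pairs-unique (suc n) = subst Unique (sym (pairs-suc n))
  (Uniqueₚ.++⁺ (Uniqueₚ.map⁺ (Finₚ.suc-injective ∘ cong proj₂) (Uniqueₚ.allFin⁺ n))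
               (Uniqueₚ.map⁺ sucPair-injective (pairs-unique n))
               disjoint)
  where
  sucPair-injective : ∀ {p q : Fin n × Fin n} → sucPair p ≡ sucPair q → p ≡ q
  sucPair-injective eq = cong₂ _,_ (Finₚ.suc-injective (cong proj₁ eq)) (Finₚ.suc-injective (cong proj₂ eq))
  disjoint : ∀ {p} → p ∈ firstRow n × p ∈ List.map sucPair (pairs n) → ⊥
  disjoint (p∈first , p∈later) with ∈ₚ.∈-map⁻ _ p∈first | ∈ₚ.∈-map⁻ sucPair p∈later
  ... | _ , _ , refl | _ , _ , ()

∈-pairs⁻ : (n : ℕ) {p : Fin n × Fin n} → p ∈ pairs n → toℕ (proj₁ p) < toℕ (proj₂ p)
∈-pairs⁻ (suc n) p∈ with ∈ₚ.∈-++⁻ (firstRow n) (subst (_ ∈_) (pairs-suc n) p∈)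
... | inj₁ p∈first with ∈ₚ.∈-map⁻ _ p∈first
...   | _ , _ , refl = s≤s z≤n
∈-pairs⁻ (suc n) p∈ | inj₂ p∈later with ∈ₚ.∈-map⁻ sucPair p∈later
...   | _ , q∈ , refl = s≤s (∈-pairs⁻ n q∈)

∈-pairs⁺ : (n : ℕ) (i j : Fin n) → toℕ i < toℕ j → (i , j) ∈ pairs n
∈-pairs⁺ (suc n) Fin.zero    (Fin.suc j) _     = subst ((Fin.zero , Fin.suc j) ∈_) (sym (pairs-suc n))
  (∈ₚ.∈-++⁺ˡ (∈ₚ.∈-map⁺ (λ j → Fin.zero , Fin.suc j) (∈ₚ.∈-allFin j)))
∈-pairs⁺ (suc n) (Fin.suc i) (Fin.suc j) i<j = subst ((Fin.suc i , Fin.suc j) ∈_) (sym (pairs-suc n))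
  (∈ₚ.∈-++⁺ʳ (firstRow n) (∈ₚ.∈-map⁺ sucPair (∈-pairs⁺ n i j (ℕ.s≤s⁻¹ i<j))))

map-flipPair-pairs : (n : ℕ) → List.map flipPair (pairs n) ↭ pairs n
map-flipPair-pairs n = map-involution-↭ flipPair flipPair-involutive (pairs-unique n) (pairs-unique n) flip∈ flip∈
  where
  flipPair-involutive : (p : Fin n × Fin n) → flipPair (flipPair p) ≡ p
  flipPair-involutive (i , j) = cong₂ _,_ (Finₚ.opposite-involutive i) (Finₚ.opposite-involutive j)
  opposite-< : (i j : Fin n) → toℕ i < toℕ j → toℕ (opposite j) < toℕ (opposite i)
  opposite-< i j i<j rewrite Finₚ.opposite-prop i | Finₚ.opposite-prop j = ℕₚ.∸-monoʳ-< (s≤s i<j) (Finₚ.toℕ<n j)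
  flip∈ : ∀ {p} → p ∈ pairs n → flipPair p ∈ pairs n
  flip∈ {i , j} p∈ = ∈-pairs⁺ n (opposite j) (opposite i) (opposite-< i j (∈-pairs⁻ n p∈))

sumᵛ-++ : (xs ys : List (Vec ℕ n)) → sumᵛ (xs ++ ys) ≡ sumᵛ xs +ᵛ sumᵛ ys
sumᵛ-++ []       ys = sym (+ᵛ-identityˡ (sumᵛ ys))
sumᵛ-++ (x ∷ xs) ys = trans (cong (x +ᵛ_) (sumᵛ-++ xs ys)) (sym (+ᵛ-assoc x (sumᵛ xs) (sumᵛ ys)))

sumᵛ-map-∷ : (c : ℕ) (xs : List (Vec ℕ n)) → sumᵛ (List.map (c ∷_) xs) ≡ (length xs * c) ∷ sumᵛ xs
sumᵛ-map-∷ c []       = refl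
sumᵛ-map-∷ c (x ∷ xs) = cong ((c ∷ x) +ᵛ_) (sumᵛ-map-∷ c xs)

sumᵛ-unitVec : (n : ℕ) → sumᵛ (List.map unitVec (allFin n)) ≡ replicate n 1
sumᵛ-unitVec zero    = refl
sumᵛ-unitVec (suc n) = begin
  sumᵛ (List.map unitVec (allFin (suc n)))
    ≡⟨ cong (sumᵛ ∘ List.map unitVec) (allFin-suc n) ⟩
  unitVec Fin.zero +ᵛ sumᵛ (List.map unitVec (List.map Fin.suc (allFin n)))
    ≡⟨ cong₂ _+ᵛ_ unitVec-zero (cong sumᵛ map-unitVec-suc) ⟩
  (1 ∷ replicate n 0) +ᵛ sumᵛ (List.map (0 ∷_) units)
    ≡⟨ cong ((1 ∷ replicate n 0) +ᵛ_) (sumᵛ-map-∷ 0 units) ⟩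
  (1 ∷ replicate n 0) +ᵛ ((length units * 0) ∷ sumᵛ units)
    ≡⟨ cong₂ (λ z v → (1 ∷ replicate n 0) +ᵛ (z ∷ v)) (ℕₚ.*-zeroʳ (length units)) (sumᵛ-unitVec n) ⟩
  (1 ∷ replicate n 0) +ᵛ (0 ∷ replicate n 1)
    ≡⟨ cong (1 ∷_) (+ᵛ-identityˡ (replicate n 1)) ⟩
  replicate (suc n) 1 ∎
  where
  open ≡-Reasoning
  units : List (Vec ℕ n)
  units = List.map unitVec (allFin n)
  map-unitVec-suc : List.map unitVec (List.map Fin.suc (allFin n)) ≡ List.map (0 ∷_) units
  map-unitVec-suc = trans (sym (Listₚ.map-∘ (allFin n))) (trans (Listₚ.map-cong unitVec-suc (allFin n)) (Listₚ.map-∘ (allFin n)))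

sumᵛ-factorDegree-firstRow : (n : ℕ) → sumᵛ (List.map factorDegree (firstRow n)) ≡ n ∷ replicate n 1
sumᵛ-factorDegree-firstRow n = begin
  sumᵛ (List.map factorDegree (firstRow n))                              ≡⟨ cong sumᵛ (Listₚ.map-∘ (allFin n)) ⟨
  sumᵛ (List.map (λ j → factorDegree (Fin.zero , Fin.suc j)) (allFin n)) ≡⟨ cong sumᵛ first-column ⟩
  sumᵛ (List.map (1 ∷_) units)                                           ≡⟨ sumᵛ-map-∷ 1 units ⟩
  (length units * 1) ∷ sumᵛ units                                        ≡⟨ cong₂ _∷_ length-units (sumᵛ-unitVec n) ⟩
  n ∷ replicate n 1                                                      ∎
  where
  open ≡-Reasoning
  units : List (Vec ℕ n)
  units = List.map unitVec (allFin n)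
  first-column : List.map (λ j → factorDegree (Fin.zero , Fin.suc j)) (allFin n) ≡ List.map (1 ∷_) units
  first-column = trans (Listₚ.map-cong (λ j → trans (cong₂ _+ᵛ_ unitVec-zero (unitVec-suc j))
                                                    (cong (1 ∷_) (+ᵛ-identityˡ (unitVec j)))) (allFin n))
                       (Listₚ.map-∘ (allFin n))
  length-units : length units * 1 ≡ n
  length-units = trans (ℕₚ.*-identityʳ _) (trans (Listₚ.length-map unitVec (allFin n)) (Listₚ.length-tabulate id))

sumᵛ-factorDegree-sucPair : (ps : List (Fin n × Fin n)) →
                            sumᵛ (List.map factorDegree (List.map sucPair ps)) ≡ 0 ∷ sumᵛ (List.map factorDegree ps)
sumᵛ-factorDegree-sucPair ps = begin
  sumᵛ (List.map factorDegree (List.map sucPair ps))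
    ≡⟨ cong sumᵛ (trans (sym (Listₚ.map-∘ ps)) (trans (Listₚ.map-cong factorDegree-sucPair ps) (Listₚ.map-∘ ps))) ⟩
  sumᵛ (List.map (0 ∷_) (List.map factorDegree ps))
    ≡⟨ sumᵛ-map-∷ 0 (List.map factorDegree ps) ⟩
  (length (List.map factorDegree ps) * 0) ∷ sumᵛ (List.map factorDegree ps)
    ≡⟨ cong (_∷ sumᵛ (List.map factorDegree ps)) (ℕₚ.*-zeroʳ (length (List.map factorDegree ps))) ⟩
  0 ∷ sumᵛ (List.map factorDegree ps) ∎
  where
  open ≡-Reasoning
  factorDegree-sucPair : (p : Fin _ × Fin _) → factorDegree (sucPair p) ≡ 0 ∷ factorDegree p
  factorDegree-sucPair (i , j) = cong₂ _+ᵛ_ (unitVec-suc i) (unitVec-suc j)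

sumᵛ-factorDegree-pairs : (n : ℕ) → sumᵛ (List.map factorDegree (pairs n)) ≡ replicate n (n ∸ 1)
sumᵛ-factorDegree-pairs zero    = refl
sumᵛ-factorDegree-pairs (suc n) = begin
  sumᵛ (List.map factorDegree (pairs (suc n)))
    ≡⟨ cong (sumᵛ ∘ List.map factorDegree) (pairs-suc n) ⟩
  sumᵛ (List.map factorDegree (firstRow n ++ List.map sucPair (pairs n)))
    ≡⟨ cong sumᵛ (Listₚ.map-++ factorDegree (firstRow n) (List.map sucPair (pairs n))) ⟩
  sumᵛ (List.map factorDegree (firstRow n) ++ List.map factorDegree (List.map sucPair (pairs n)))
    ≡⟨ sumᵛ-++ (List.map factorDegree (firstRow n)) _ ⟩
  sumᵛ (List.map factorDegree (firstRow n)) +ᵛ sumᵛ (List.map factorDegree (List.map sucPair (pairs n)))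
    ≡⟨ cong₂ _+ᵛ_ (sumᵛ-factorDegree-firstRow n)
                  (trans (sumᵛ-factorDegree-sucPair (pairs n)) (cong (0 ∷_) (sumᵛ-factorDegree-pairs n))) ⟩
  (n ∷ replicate n 1) +ᵛ (0 ∷ replicate n (n ∸ 1))
    ≡⟨ cong₂ _∷_ (ℕₚ.+-identityʳ n) (Vecₚ.zipWith-replicate _+_ 1 (n ∸ 1)) ⟩
  n ∷ replicate n (1 + (n ∸ 1))
    ≡⟨ cong (n ∷_) (1+[n∸1] n) ⟩
  replicate (suc n) n ∎
  where
  open ≡-Reasoning
  1+[n∸1] : (n : ℕ) → replicate n (1 + (n ∸ 1)) ≡ replicate n n
  1+[n∸1] zero    = refl
  1+[n∸1] (suc n) = refl

vandermonde-bounded : (n : ℕ) → BoundedBy (replicate n (n ∸ 1)) (vandermonde n)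
vandermonde-bounded n =
  subst₂ BoundedBy (sumᵛ-factorDegree-pairs n) (sym (vandermonde-pairs n)) (prodP-factors-bounded (pairs n))

reflectP-vandermonde : (n : ℕ) → reflectP (replicate n (n ∸ 1)) (vandermonde n) ↭ vandermonde n
reflectP-vandermonde n = subst₂ (λ c v → reflectP c v ↭ v) (sumᵛ-factorDegree-pairs n) (sym (vandermonde-pairs n)) (begin
  reflectP (sumᵛ (List.map factorDegree (pairs n))) (prodP (List.map factor (pairs n))) ≡⟨ reflectP-prodP-factors (pairs n) ⟩
  prodP (List.map (factor ∘ flipPair) (pairs n))       ≡⟨ cong prodP (Listₚ.map-∘ (pairs n)) ⟩
  prodP (List.map factor (List.map flipPair (pairs n))) ↭⟨ prodP-↭ (↭ₚ.map⁺ factor (map-flipPair-pairs n)) ⟩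
  prodP (List.map factor (pairs n))                    ∎)
  where open ↭.PermutationReasoning

-- The duality S ↦ {n + 1 − i : i ∉ S} on subsets of {1..n}

dual : Subset n → Subset n
dual S = reverse (Vec.map not S)

dual-involutive : (S : Subset n) → dual (dual S) ≡ S
dual-involutive S = begin
  reverse (Vec.map not (reverse (Vec.map not S))) ≡⟨ cong reverse (Vecₚ.map-reverse not (Vec.map not S)) ⟩
  reverse (reverse (Vec.map not (Vec.map not S))) ≡⟨ Vecₚ.reverse-involutive _ ⟩
  Vec.map not (Vec.map not S)                     ≡⟨ Vecₚ.map-∘ not not S ⟨
  Vec.map (not ∘ not) S                           ≡⟨ Vecₚ.map-cong Boolₚ.not-involutive S ⟩
  Vec.map id S                                    ≡⟨ Vecₚ.map-id S ⟩
  S                                               ∎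
  where open ≡-Reasoning

dual-injective : {S T : Subset n} → dual S ≡ dual T → S ≡ T
dual-injective {S = S} {T} eq = trans (sym (dual-involutive S)) (trans (cong dual eq) (dual-involutive T))

size-∷ʳ : (S : Subset n) (b : Bool) → size (S Vec.∷ʳ b) ≡ size S + bit b
size-∷ʳ []          true  = refl
size-∷ʳ []          false = refl
size-∷ʳ (true ∷ S)  b     = cong suc (size-∷ʳ S b)
size-∷ʳ (false ∷ S) b     = size-∷ʳ S b

size-∷ : (b : Bool) (S : Subset n) → size (b ∷ S) ≡ bit b + size S
size-∷ true  S = refl
size-∷ false S = refl

size-reverse : (S : Subset n) → size (reverse S) ≡ size S
size-reverse []      = refl
size-reverse (b ∷ S) = begin
  size (reverse (b ∷ S))    ≡⟨ cong size (Vecₚ.reverse-∷ b S) ⟩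
  size (reverse S Vec.∷ʳ b) ≡⟨ size-∷ʳ (reverse S) b ⟩
  size (reverse S) + bit b  ≡⟨ cong (_+ bit b) (size-reverse S) ⟩
  size S + bit b            ≡⟨ ℕₚ.+-comm (size S) (bit b) ⟩
  bit b + size S            ≡⟨ size-∷ b S ⟨
  size (b ∷ S)              ∎
  where open ≡-Reasoning

size-not+size : (S : Subset n) → size (Vec.map not S) + size S ≡ n
size-not+size []          = refl
size-not+size (true ∷ S)  = trans (ℕₚ.+-suc (size (Vec.map not S)) (size S)) (cong suc (size-not+size S))
size-not+size (false ∷ S) = cong suc (size-not+size S)

size-dual : (S : Subset n) → size (dual S) ≡ n ∸ size S
size-dual {n} S = begin
  size (reverse (Vec.map not S))         ≡⟨ size-reverse (Vec.map not S) ⟩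
  size (Vec.map not S)                   ≡⟨ ℕₚ.m+n∸n≡m (size (Vec.map not S)) (size S) ⟨
  size (Vec.map not S) + size S ∸ size S ≡⟨ cong (_∸ size S) (size-not+size S) ⟩
  n ∸ size S                             ∎
  where open ≡-Reasoning

∈-allSubsets : (S : Subset n) → S ∈ allSubsets n
∈-allSubsets []                  = Any.here refl
∈-allSubsets {suc n} (true ∷ S)  = ∈ₚ.∈-++⁺ˡ (∈ₚ.∈-map⁺ (true ∷_) (∈-allSubsets S))
∈-allSubsets {suc n} (false ∷ S) =
  ∈ₚ.∈-++⁺ʳ (List.map (true ∷_) (allSubsets n)) (∈ₚ.∈-map⁺ (false ∷_) (∈-allSubsets S))

allSubsets-unique : (n : ℕ) → Unique (allSubsets n)
allSubsets-unique zero    = [] AllPairs.∷ AllPairs.[]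
allSubsets-unique (suc n) =
  Uniqueₚ.++⁺ (Uniqueₚ.map⁺ Vecₚ.∷-injectiveʳ (allSubsets-unique n))
              (Uniqueₚ.map⁺ Vecₚ.∷-injectiveʳ (allSubsets-unique n))
              disjoint
  where
  disjoint : ∀ {S} → S ∈ List.map (true ∷_) (allSubsets n) × S ∈ List.map (false ∷_) (allSubsets n) → ⊥
  disjoint (S∈true , S∈false) with ∈ₚ.∈-map⁻ (true ∷_) S∈true | ∈ₚ.∈-map⁻ (false ∷_) S∈false
  ... | _ , _ , refl | _ , _ , ()

hasSize? : (k : ℕ) (S : Subset n) → Dec (T ⌊ size S ℕ.≟ k ⌋)
hasSize? k S = Bool.T? ⌊ size S ℕ.≟ k ⌋

∈-kSubsets⁺ : {k : ℕ} {S : Subset n} → size S ≡ k → S ∈ kSubsets n k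
∈-kSubsets⁺ {k = k} {S} eq = ∈ₚ.∈-filter⁺ (hasSize? k) (∈-allSubsets S) (Dec.fromWitness eq)

∈-kSubsets⁻ : {k : ℕ} {S : Subset n} → S ∈ kSubsets n k → size S ≡ k
∈-kSubsets⁻ {n} {k} S∈ = Dec.toWitness (proj₂ (∈ₚ.∈-filter⁻ (hasSize? k) {xs = allSubsets n} S∈))

kSubsets-unique : (n k : ℕ) → Unique (kSubsets n k)
kSubsets-unique n k = Uniqueₚ.filter⁺ (hasSize? k) (allSubsets-unique n)

map-dual-kSubsets : {k : ℕ} → k ≤ n → List.map dual (kSubsets n k) ↭ kSubsets n (n ∸ k)
map-dual-kSubsets {n} {k} k≤n =
  map-involution-↭ dual dual-involutive (kSubsets-unique n k) (kSubsets-unique n (n ∸ k)) to from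
  where
  to : ∀ {S} → S ∈ kSubsets n k → dual S ∈ kSubsets n (n ∸ k)
  to {S} S∈ = ∈-kSubsets⁺ (trans (size-dual S) (cong (n ∸_) (∈-kSubsets⁻ S∈)))
  from : ∀ {S} → S ∈ kSubsets n (n ∸ k) → dual S ∈ kSubsets n k
  from {S} S∈ = ∈-kSubsets⁺ (trans (size-dual S) (trans (cong (n ∸_) (∈-kSubsets⁻ S∈)) (ℕₚ.m∸[m∸n]≡n k≤n)))

reflect-replicate : (m : ℕ) (e : Vec ℕ n) → reflect (replicate n m) e ≡ complement m e
reflect-replicate m e = cong reverse (Vecₚ.zipWith-replicate₁ _∸_ m e)

indicator-bounded : (S : Subset n) → indicator S ≤ᵛ replicate n 1
indicator-bounded []          = []
indicator-bounded (true ∷ S)  = ℕₚ.≤-refl ∷ indicator-bounded S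
indicator-bounded (false ∷ S) = z≤n ∷ indicator-bounded S

degree-bounded : (K : List (Subset n)) → degree K ≤ᵛ replicate n (length K)
degree-bounded []      = ≤ᵛ-refl
degree-bounded {n} (S ∷ K) = subst (degree (S ∷ K) ≤ᵛ_) (Vecₚ.zipWith-replicate _+_ 1 (length K))
  (+ᵛ-mono-≤ᵛ (indicator-bounded S) (degree-bounded K))

indicator-dual : (S : Subset n) → indicator (dual S) ≡ reflect (replicate n 1) (indicator S)
indicator-dual S = begin
  Vec.map bit (reverse (Vec.map not S))     ≡⟨ Vecₚ.map-reverse bit (Vec.map not S) ⟩
  reverse (Vec.map bit (Vec.map not S))     ≡⟨ cong reverse (Vecₚ.map-∘ bit not S) ⟨
  reverse (Vec.map (bit ∘ not) S)           ≡⟨ cong reverse (Vecₚ.map-cong bit-not S) ⟩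
  reverse (Vec.map ((1 ∸_) ∘ bit) S)        ≡⟨ cong reverse (Vecₚ.map-∘ (1 ∸_) bit S) ⟩
  reverse (Vec.map (1 ∸_) (indicator S))    ≡⟨ reflect-replicate 1 (indicator S) ⟨
  reflect (replicate _ 1) (indicator S)     ∎
  where
  open ≡-Reasoning
  bit-not : (b : Bool) → bit (not b) ≡ 1 ∸ bit b
  bit-not true  = refl
  bit-not false = refl

degree-dual : (K : List (Subset n)) → degree (List.map dual K) ≡ reflect (replicate n (length K)) (degree K)
degree-dual {n} []      = sym (trans (reflect-replicate 0 (replicate n 0))
  (trans (cong reverse (Vecₚ.map-replicate (0 ∸_) 0 n)) (reverse-replicate 0)))
degree-dual {n} (S ∷ K) = begin
  indicator (dual S) +ᵛ degree (List.map dual K)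
    ≡⟨ cong₂ _+ᵛ_ (indicator-dual S) (degree-dual K) ⟩
  reflect (replicate n 1) (indicator S) +ᵛ reflect (replicate n (length K)) (degree K)
    ≡⟨ reflect-+ᵛ (indicator-bounded S) (degree-bounded K) ⟨
  reflect (replicate n 1 +ᵛ replicate n (length K)) (degree (S ∷ K))
    ≡⟨ cong (λ c → reflect c (degree (S ∷ K))) (Vecₚ.zipWith-replicate _+_ 1 (length K)) ⟩
  reflect (replicate n (suc (length K))) (degree (S ∷ K)) ∎
  where open ≡-Reasoning

degree-↭ : {K L : List (Subset n)} → K ↭ L → degree K ≡ degree L
degree-↭ ↭.refl                 = refl
degree-↭ (prep S K↭L)           = cong (indicator S +ᵛ_) (degree-↭ K↭L)
degree-↭ {K = S ∷ T ∷ K} (swap _ _ K↭L) =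
  trans (+ᵛ-lcomm (indicator S) (indicator T) (degree K)) (cong (λ d → indicator T +ᵛ (indicator S +ᵛ d)) (degree-↭ K↭L))
degree-↭ (↭.trans K↭L L↭M)      = trans (degree-↭ K↭L) (degree-↭ L↭M)

-- The componentwise order as a ballot walk

step : ℕ → Bool → Bool → Maybe ℕ
step d       true  false = just (suc d)
step d       true  true  = just d
step d       false false = just d
step zero    false true  = nothing
step (suc d) false true  = just d

-- From height d, walk d S T moves up at each element of S and down at each element of T, and fails
-- below zero. Hence S ≤ T iff walk 0 S T ends at zero: every prefix of {1..n} then meets S at least as
-- often as T, and both sets have the same size.
walk : ℕ → Subset n → Subset n → Maybe ℕ
walk d []      []      = just d
walk d (s ∷ S) (t ∷ T) = step d s t >>= λ d′ → walk d′ S T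

endsAtZero : Maybe ℕ → Bool
endsAtZero (just zero) = true
endsAtZero _           = false

pointwiseLeq-elemsFrom-above : {i j : ℕ} → i < j → (S : Subset n) (ys : List ℕ) →
                               pointwiseLeq (elemsFrom j S) (i ∷ ys) ≡ false
pointwiseLeq-elemsFrom-above i<j []          ys = refl
pointwiseLeq-elemsFrom-above {i = i} {j} i<j (true ∷ S) ys =
  cong (_∧ pointwiseLeq (elemsFrom (suc j) S) ys) (⌊⌋-false (j ℕ.≤? i) (ℕₚ.<⇒≱ i<j))
pointwiseLeq-elemsFrom-above i<j (false ∷ S) ys = pointwiseLeq-elemsFrom-above (ℕₚ.m<n⇒m<1+n i<j) S ys

⌊≤?⌋-∧ : {p i : ℕ} → p ≤ i → (b : Bool) → ⌊ p ℕ.≤? i ⌋ ∧ b ≡ b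
⌊≤?⌋-∧ {p} {i} p≤i b = cong (_∧ b) (⌊⌋-true (p ℕ.≤? i) p≤i)

push-pending : (i : ℕ) (P : List ℕ) (S T : Subset n) → All (_< i) P →
  pointwiseLeq (P ++ i ∷ elemsFrom (suc i) S) (elemsFrom (suc i) T) ≡ endsAtZero (walk (suc (length P)) S T)

-- P lists the elements of S already read whose partner in T has not yet appeared.
pointwiseLeq-walk : (i : ℕ) (P : List ℕ) (S T : Subset n) → All (_< i) P →
                    pointwiseLeq (P ++ elemsFrom i S) (elemsFrom i T) ≡ endsAtZero (walk (length P) S T)
pointwiseLeq-walk i []      []          []          _           = refl
pointwiseLeq-walk i (_ ∷ _) []          []          _           = refl
pointwiseLeq-walk i P       (true ∷ S)  (false ∷ T) P<i         = push-pending i P S T P<i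
pointwiseLeq-walk i []      (false ∷ S) (true ∷ T)  _           =
  pointwiseLeq-elemsFrom-above ℕₚ.≤-refl S (elemsFrom (suc i) T)
pointwiseLeq-walk i (p ∷ P) (false ∷ S) (true ∷ T)  (p<i ∷ P<i) =
  trans (⌊≤?⌋-∧ (ℕₚ.<⇒≤ p<i) _) (pointwiseLeq-walk (suc i) P S T (All.map ℕₚ.m<n⇒m<1+n P<i))
pointwiseLeq-walk i []      (true ∷ S)  (true ∷ T)  _           =
  trans (⌊≤?⌋-∧ ℕₚ.≤-refl _) (pointwiseLeq-walk (suc i) [] S T [])
pointwiseLeq-walk i (p ∷ P) (true ∷ S)  (true ∷ T)  (p<i ∷ P<i) =
  trans (⌊≤?⌋-∧ (ℕₚ.<⇒≤ p<i) _) (push-pending i P S T P<i)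
pointwiseLeq-walk i P       (false ∷ S) (false ∷ T) P<i         =
  pointwiseLeq-walk (suc i) P S T (All.map ℕₚ.m<n⇒m<1+n P<i)

push-pending i P S T P<i = begin
  pointwiseLeq (P ++ i ∷ elemsFrom (suc i) S) (elemsFrom (suc i) T)
    ≡⟨ cong (λ xs → pointwiseLeq xs (elemsFrom (suc i) T)) (Listₚ.++-assoc P (i ∷ []) (elemsFrom (suc i) S)) ⟨
  pointwiseLeq ((P ++ i ∷ []) ++ elemsFrom (suc i) S) (elemsFrom (suc i) T)
    ≡⟨ pointwiseLeq-walk (suc i) (P ++ i ∷ []) S T (Allₚ.∷ʳ⁺ (All.map ℕₚ.m<n⇒m<1+n P<i) ℕₚ.≤-refl) ⟩
  endsAtZero (walk (length (P ++ i ∷ [])) S T)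
    ≡⟨ cong (λ d → endsAtZero (walk d S T))
            (trans (Listₚ.length-++-sucʳ P i []) (cong (suc ∘ length) (Listₚ.++-identityʳ P))) ⟩
  endsAtZero (walk (suc (length P)) S T) ∎
  where open ≡-Reasoning

leqSet-walk : (S T : Subset n) → leqSet S T ≡ endsAtZero (walk 0 S T)
leqSet-walk S T = pointwiseLeq-walk 1 [] S T []

>>=-cong : (m : Maybe A) {f g : A → Maybe B} → (∀ x → f x ≡ g x) → (m >>= f) ≡ (m >>= g)
>>=-cong nothing  f≗g = refl
>>=-cong (just x) f≗g = f≗g x

>>=-assoc : (m : Maybe A) (f : A → Maybe B) (g : B → Maybe C) → ((m >>= f) >>= g) ≡ (m >>= λ x → f x >>= g)
>>=-assoc nothing  f g = refl
>>=-assoc (just x) f g = refl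

>>=-identityʳ : (m : Maybe A) → (m >>= just) ≡ m
>>=-identityʳ nothing  = refl
>>=-identityʳ (just x) = refl

step-not : (d : ℕ) (s t : Bool) → step d (not s) (not t) ≡ step d t s
step-not d true  true  = refl
step-not d true  false = refl
step-not d false true  = refl
step-not d false false = refl

step-reverse : {d e : ℕ} (s t : Bool) → step d s t ≡ just e → step e t s ≡ just d
step-reverse {d}     true  false refl = refl
step-reverse {d}     true  true  refl = refl
step-reverse {d}     false false refl = refl
step-reverse {suc d} false true  refl = refl

walk-not : (d : ℕ) (S T : Subset n) → walk d (Vec.map not S) (Vec.map not T) ≡ walk d T S
walk-not d []      []      = refl
walk-not d (s ∷ S) (t ∷ T) =
  trans (cong (_>>= λ d′ → walk d′ (Vec.map not S) (Vec.map not T)) (step-not d s t))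
        (>>=-cong (step d t s) (λ d′ → walk-not d′ S T))

walk-∷ʳ : (d : ℕ) (S T : Subset n) (s t : Bool) →
          walk d (S Vec.∷ʳ s) (T Vec.∷ʳ t) ≡ (walk d S T >>= λ d′ → step d′ s t)
walk-∷ʳ d []      []      s t = >>=-identityʳ (step d s t)
walk-∷ʳ d (x ∷ S) (y ∷ T) s t =
  trans (>>=-cong (step d x y) (λ d′ → walk-∷ʳ d′ S T s t))
        (sym (>>=-assoc (step d x y) (λ d′ → walk d′ S T) (λ d′ → step d′ s t)))

walk-reverse : {d e : ℕ} (S T : Subset n) → walk d S T ≡ just e → walk e (reverse T) (reverse S) ≡ just d
walk-reverse {d = d} []      []      refl = refl
walk-reverse {d = d} {e} (s ∷ S) (t ∷ T) eq with step d s t in step≡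
... | just d′ = begin
  walk e (reverse (t ∷ T)) (reverse (s ∷ S))             ≡⟨ cong₂ (walk e) (Vecₚ.reverse-∷ t T) (Vecₚ.reverse-∷ s S) ⟩
  walk e (reverse T Vec.∷ʳ t) (reverse S Vec.∷ʳ s)       ≡⟨ walk-∷ʳ e (reverse T) (reverse S) t s ⟩
  (walk e (reverse T) (reverse S) >>= λ x → step x t s)  ≡⟨ cong (_>>= λ x → step x t s) (walk-reverse S T eq) ⟩
  step d′ t s                                            ≡⟨ step-reverse s t step≡ ⟩
  just d                                                 ∎
  where open ≡-Reasoning

endsAtZero-cong : {x y : Maybe ℕ} → (x ≡ just 0 → y ≡ just 0) → (y ≡ just 0 → x ≡ just 0) →
                  endsAtZero x ≡ endsAtZero y
endsAtZero-cong {just zero}    to from rewrite to refl   = refl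
endsAtZero-cong {y = just zero} to from rewrite from refl = refl
endsAtZero-cong {nothing}      {nothing}      _ _ = refl
endsAtZero-cong {nothing}      {just (suc _)} _ _ = refl
endsAtZero-cong {just (suc _)} {nothing}      _ _ = refl
endsAtZero-cong {just (suc _)} {just (suc _)} _ _ = refl

leqSet-dual : (S T : Subset n) → leqSet (dual S) (dual T) ≡ leqSet S T
leqSet-dual S T = begin
  leqSet (dual S) (dual T)                                  ≡⟨ leqSet-walk (dual S) (dual T) ⟩
  endsAtZero (walk 0 (dual S) (dual T))                     ≡⟨ endsAtZero-cong (walk-reverse (dual S) (dual T)) backwards ⟩
  endsAtZero (walk 0 (reverse (dual T)) (reverse (dual S))) ≡⟨ cong₂ (λ S′ T′ → endsAtZero (walk 0 S′ T′))
                                                                     (Vecₚ.reverse-involutive (Vec.map not T))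
                                                                     (Vecₚ.reverse-involutive (Vec.map not S)) ⟩
  endsAtZero (walk 0 (Vec.map not T) (Vec.map not S))       ≡⟨ cong endsAtZero (walk-not 0 T S) ⟩
  endsAtZero (walk 0 S T)                                   ≡⟨ leqSet-walk S T ⟨
  leqSet S T                                                ∎
  where
  open ≡-Reasoning
  backwards : walk 0 (reverse (dual T)) (reverse (dual S)) ≡ just 0 → walk 0 (dual S) (dual T) ≡ just 0
  backwards eq = subst₂ (λ S′ T′ → walk 0 S′ T′ ≡ just 0)
    (Vecₚ.reverse-involutive (dual S)) (Vecₚ.reverse-involutive (dual T))
    (walk-reverse (reverse (dual T)) (reverse (dual S)) eq)

isShifted-↭ : (k : ℕ) {K L : List (Subset n)} → K ↭ L → isShifted k K ≡ isShifted k L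
isShifted-↭ {n} k {K} {L} K↭L = trans (cong and (Listₚ.map-cong members-↭ K)) (all-↭ _ K↭L)
  where
  members-↭ : (S : Subset n) → all (λ T → not (leqSet T S) ∨ member T K) (kSubsets n k)
                              ≡ all (λ T → not (leqSet T S) ∨ member T L) (kSubsets n k)
  members-↭ S = cong and (Listₚ.map-cong (λ T → cong (not (leqSet T S) ∨_) (any-↭ _ K↭L)) (kSubsets n k))

member-dual : (T : Subset n) (K : List (Subset n)) → member (dual T) (List.map dual K) ≡ member T K
member-dual T K = trans (cong or (sym (Listₚ.map-∘ K)))
  (cong or (Listₚ.map-cong (λ S → ⌊⌋-⇔ (mk⇔ dual-injective (cong dual)) (≡-dec Bool._≟_ (dual T) (dual S))
                                                                          (≡-dec Bool._≟_ T S)) K))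

isShifted-dual : {k : ℕ} → k ≤ n → (K : List (Subset n)) → isShifted (n ∸ k) (List.map dual K) ≡ isShifted k K
isShifted-dual {n} {k} k≤n K = trans (cong and (sym (Listₚ.map-∘ K))) (cong and (Listₚ.map-cong below-dual K))
  where
  open ≡-Reasoning
  below-dual : (S : Subset n) →
    all (λ T → not (leqSet T (dual S)) ∨ member T (List.map dual K)) (kSubsets n (n ∸ k)) ≡
    all (λ T → not (leqSet T S) ∨ member T K) (kSubsets n k)
  below-dual S = begin
    all (λ T → not (leqSet T (dual S)) ∨ member T (List.map dual K)) (kSubsets n (n ∸ k))
      ≡⟨ all-↭ _ (↭-sym (map-dual-kSubsets k≤n)) ⟩
    all (λ T → not (leqSet T (dual S)) ∨ member T (List.map dual K)) (List.map dual (kSubsets n k))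
      ≡⟨ cong and (sym (Listₚ.map-∘ (kSubsets n k))) ⟩
    all (λ T → not (leqSet (dual T) (dual S)) ∨ member (dual T) (List.map dual K)) (kSubsets n k)
      ≡⟨ cong and (Listₚ.map-cong (λ T → cong₂ (λ b c → not b ∨ c) (leqSet-dual T S) (member-dual T K)) (kSubsets n k)) ⟩
    all (λ T → not (leqSet T S) ∨ member T K) (kSubsets n k) ∎

-- Families up to reordering both the family and its members

module Nested {A : Set} = PermutationSetoid (↭-setoid {A = A})
module Nestedₚ {A : Set} = PermutationSetoidₚ (↭-setoid {A = A})

infix 3 _↭↭_
_↭↭_ : List (List A) → List (List A) → Set
_↭↭_ = Nested._↭_

map-cong-↭↭ : {f g : List A → List A} → (∀ xs → f xs ↭ g xs) → (xss : List (List A)) →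
              List.map f xss ↭↭ List.map g xss
map-cong-↭↭ f↭g xss = Nested.↭-reflexive-≋ (ListPointwise.map⁺ _ _ (ListPointwise.refl (f↭g _)))

sublists-↭↭ : {A : Set} {xs ys : List A} → xs ↭ ys → sublists xs ↭↭ sublists ys
sublists-↭↭ ↭.refl             = Nested.↭-refl
sublists-↭↭ (prep x xs↭ys)     =
  Nestedₚ.++⁺ (Nestedₚ.map⁺ ↭-setoid (prep x) (sublists-↭↭ xs↭ys)) (sublists-↭↭ xs↭ys)
sublists-↭↭ {A} {x ∷ y ∷ xs} {y ∷ x ∷ ys} (swap _ _ xs↭ys) = begin
  sublists (x ∷ y ∷ xs)
    ≡⟨ expand x y xs ⟩
  List.map (x ∷_) (List.map (y ∷_) S) ++ (List.map (x ∷_) S ++ (List.map (y ∷_) S ++ S))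
    ↭⟨ Nestedₚ.++⁺ˡ (List.map (x ∷_) (List.map (y ∷_) S)) (Nestedₚ.shifts (List.map (x ∷_) S) (List.map (y ∷_) S)) ⟩
  List.map (x ∷_) (List.map (y ∷_) S) ++ (List.map (y ∷_) S ++ (List.map (x ∷_) S ++ S))
    ↭⟨ Nestedₚ.++⁺ both-heads (Nestedₚ.++⁺ (head y) (Nestedₚ.++⁺ (head x) IH)) ⟩
  List.map (y ∷_) (List.map (x ∷_) S′) ++ (List.map (y ∷_) S′ ++ (List.map (x ∷_) S′ ++ S′))
    ≡⟨ expand y x ys ⟨
  sublists (y ∷ x ∷ ys) ∎
  where
  open Nested.PermutationReasoning
  S S′ : List (List A)
  S = sublists xs
  S′ = sublists ys
  IH : S ↭↭ S′
  IH = sublists-↭↭ xs↭ys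
  expand : (x y : A) (xs : List A) → sublists (x ∷ y ∷ xs) ≡
    List.map (x ∷_) (List.map (y ∷_) (sublists xs)) ++
    (List.map (x ∷_) (sublists xs) ++ (List.map (y ∷_) (sublists xs) ++ sublists xs))
  expand x y xs = trans (cong (_++ _) (Listₚ.map-++ (x ∷_) (List.map (y ∷_) (sublists xs)) (sublists xs)))
                        (Listₚ.++-assoc (List.map (x ∷_) (List.map (y ∷_) (sublists xs))) _ _)
  head : ∀ z → List.map (z ∷_) S ↭↭ List.map (z ∷_) S′
  head z = Nestedₚ.map⁺ ↭-setoid (prep z) IH
  both-heads : List.map (x ∷_) (List.map (y ∷_) S) ↭↭ List.map (y ∷_) (List.map (x ∷_) S′)
  both-heads = begin
    List.map (x ∷_) (List.map (y ∷_) S)    ≡⟨ Listₚ.map-∘ S ⟨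
    List.map (λ zs → x ∷ y ∷ zs) S         ↭⟨ Nestedₚ.map⁺ ↭-setoid (λ r → prep x (prep y r)) IH ⟩
    List.map (λ zs → x ∷ y ∷ zs) S′        ↭⟨ map-cong-↭↭ (λ zs → swap x y ↭-refl) S′ ⟩
    List.map (λ zs → y ∷ x ∷ zs) S′        ≡⟨ Listₚ.map-∘ S′ ⟩
    List.map (y ∷_) (List.map (x ∷_) S′)   ∎
sublists-↭↭ (↭.trans xs↭ys ys↭zs) = Nested.↭-trans (sublists-↭↭ xs↭ys) (sublists-↭↭ ys↭zs)

sublists-map : (f : A → B) (xs : List A) → sublists (List.map f xs) ≡ List.map (List.map f) (sublists xs)
sublists-map f []       = refl
sublists-map f (x ∷ xs) = begin
  List.map (f x ∷_) (sublists (List.map f xs)) ++ sublists (List.map f xs)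
    ≡⟨ cong (λ yss → List.map (f x ∷_) yss ++ yss) (sublists-map f xs) ⟩
  List.map (f x ∷_) (List.map (List.map f) (sublists xs)) ++ List.map (List.map f) (sublists xs)
    ≡⟨ cong (_++ List.map (List.map f) (sublists xs)) (trans (sym (Listₚ.map-∘ (sublists xs))) (Listₚ.map-∘ (sublists xs))) ⟩
  List.map (List.map f) (List.map (x ∷_) (sublists xs)) ++ List.map (List.map f) (sublists xs)
    ≡⟨ Listₚ.map-++ (List.map f) (List.map (x ∷_) (sublists xs)) (sublists xs) ⟨
  List.map (List.map f) (sublists (x ∷ xs)) ∎
  where open ≡-Reasoning

hasLength : ℕ → List A → Bool
hasLength m K = ⌊ length K ℕ.≟ m ⌋

families-length : (n k m : ℕ) → All (λ K → length K ≡ m) (families n k m)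
families-length n k m = All.map Dec.toWitness (Allₚ.all-filter (Bool.T? ∘ hasLength m) (sublists (kSubsets n k)))

families-dual : {k : ℕ} → k ≤ n → (m : ℕ) → List.map (List.map dual) (families n k m) ↭↭ families n (n ∸ k) m
families-dual {n} {k} k≤n m = begin
  List.map (List.map dual) (filterᵇ (hasLength m) (sublists (kSubsets n k)))
    ≡⟨ filterᵇ-map (hasLength m) (hasLength m) (List.map dual) (All.universal length-dual (sublists (kSubsets n k))) ⟨
  filterᵇ (hasLength m) (List.map (List.map dual) (sublists (kSubsets n k)))
    ≡⟨ cong (filterᵇ (hasLength m)) (sublists-map dual (kSubsets n k)) ⟨
  filterᵇ (hasLength m) (sublists (List.map dual (kSubsets n k)))
    ↭⟨ Nestedₚ.filter⁺ (Bool.T? ∘ hasLength m) hasLength-resp-↭ (sublists-↭↭ (map-dual-kSubsets k≤n)) ⟩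
  filterᵇ (hasLength m) (sublists (kSubsets n (n ∸ k))) ∎
  where
  open Nested.PermutationReasoning
  length-dual : (K : List (Subset n)) → hasLength m (List.map dual K) ≡ hasLength m K
  length-dual K = cong (λ l → ⌊ l ℕ.≟ m ⌋) (Listₚ.length-map dual K)
  hasLength-resp-↭ : ∀ {K L : List (Subset n)} → K ↭ L → T (hasLength m K) → T (hasLength m L)
  hasLength-resp-↭ K↭L = subst (λ l → T ⌊ l ℕ.≟ m ⌋) (↭ₚ.↭-length K↭L)

plethysm-bounded : (n k m : ℕ) → BoundedBy (replicate n m) (plethysm n k m)
plethysm-bounded n k m = Allₚ.map⁺ (All.map (λ {K} |K|≡m →
  subst (λ l → degree K ≤ᵛ replicate n l) |K|≡m (degree-bounded K)) (families-length n k m))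

reflectP-plethysm : {k : ℕ} → k ≤ n → (m : ℕ) → reflectP (replicate n m) (plethysm n k m) ↭ plethysm n (n ∸ k) m
reflectP-plethysm {n} {k} k≤n m = begin
  reflectP (replicate n m) (List.map term (families n k m))   ≡⟨ Listₚ.map-∘ (families n k m) ⟨
  List.map (reflectᵗ (replicate n m) ∘ term) (families n k m)
    ≡⟨ Listₚ.map-cong-local (All.map (λ {K} → term-dual {K}) (families-length n k m)) ⟩
  List.map (term ∘ List.map dual) (families n k m)            ≡⟨ Listₚ.map-∘ (families n k m) ⟩
  List.map term (List.map (List.map dual) (families n k m))
    ↭⟨ ↭ₛ⇒↭ (Nestedₚ.map⁺ (≡.setoid (Term n)) (cong (+ 1 ,_) ∘ degree-↭) (families-dual k≤n m)) ⟩
  List.map term (families n (n ∸ k) m)                        ∎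
  where
  open ↭.PermutationReasoning
  term : List (Subset n) → Term n
  term K = (+ 1 , degree K)
  term-dual : ∀ {K : List (Subset n)} → length K ≡ m → reflectᵗ (replicate n m) (term K) ≡ term (List.map dual K)
  term-dual {K} refl = cong (+ 1 ,_) (sym (degree-dual K))

delta-bounded : (n : ℕ) → delta n ≤ᵛ replicate n (n ∸ 1)
delta-bounded n = ≤ᵛ-lookup⁺ (delta n) (replicate n (n ∸ 1)) λ i →
  subst₂ _≤_ (sym (Vecₚ.lookup∘tabulate _ i)) (sym (Vecₚ.lookup-replicate i (n ∸ 1))) (ℕₚ.∸-monoʳ-≤ n (s≤s z≤n))

reflect-delta : (n : ℕ) → reflect (replicate n (n ∸ 1)) (delta n) ≡ delta n
reflect-delta zero    = refl
reflect-delta (suc n) = lookup-ext λ i → begin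
  lookup (reflect (replicate (suc n) n) (delta (suc n))) i
    ≡⟨ lookup-reverse (zipWith _∸_ (replicate (suc n) n) (delta (suc n))) i ⟩
  lookup (zipWith _∸_ (replicate (suc n) n) (delta (suc n))) (opposite i)
    ≡⟨ Vecₚ.lookup-zipWith _∸_ (opposite i) (replicate (suc n) n) (delta (suc n)) ⟩
  lookup (replicate (suc n) n) (opposite i) ∸ lookup (delta (suc n)) (opposite i)
    ≡⟨ cong₂ _∸_ (Vecₚ.lookup-replicate (opposite i) n) (Vecₚ.lookup∘tabulate δ (opposite i)) ⟩
  n ∸ (n ∸ toℕ (opposite i))
    ≡⟨ ℕₚ.m∸[m∸n]≡n (Finₚ.toℕ≤pred[n] (opposite i)) ⟩
  toℕ (opposite i)
    ≡⟨ Finₚ.opposite-prop i ⟩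
  suc n ∸ suc (toℕ i)
    ≡⟨ Vecₚ.lookup∘tabulate δ i ⟨
  lookup (delta (suc n)) i ∎
  where
  open ≡-Reasoning
  δ : Fin (suc n) → ℕ
  δ j = suc n ∸ suc (toℕ j)

partition-bounded : {λ' : Vec ℕ n} → IsPartition λ' → (m : ℕ) → first λ' ≤ m → λ' ≤ᵛ replicate n m
partition-bounded {λ' = []}    _          m _   = []
partition-bounded {λ' = x ∷ λ'} decreasing m x≤m = ≤ᵛ-lookup⁺ (x ∷ λ') (replicate _ m) λ i →
  subst (lookup (x ∷ λ') i ≤_) (sym (Vecₚ.lookup-replicate i m)) (ℕₚ.≤-trans (decreasing Fin.zero i z≤n) x≤m)

exponentBound : (n m : ℕ) → Vec ℕ n
exponentBound n m = replicate n (n ∸ 1) +ᵛ replicate n m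

vandermonde*plethysm-bounded : (n k m : ℕ) → BoundedBy (exponentBound n m) (vandermonde n *P plethysm n k m)
vandermonde*plethysm-bounded n k m = *P-bounded (vandermonde-bounded n) (plethysm-bounded n k m)

reflectP-vandermonde*plethysm : {k : ℕ} → k ≤ n → (m : ℕ) →
  reflectP (exponentBound n m) (vandermonde n *P plethysm n k m) ↭ vandermonde n *P plethysm n (n ∸ k) m
reflectP-vandermonde*plethysm {n} k≤n m = ↭-trans
  (↭-reflexive (reflectP-*P (vandermonde-bounded n) (plethysm-bounded n _ m)))
  (*P-cong (reflectP-vandermonde n) (reflectP-plethysm k≤n m))

λ+δ-bounded : {λ' : Vec ℕ n} {m : ℕ} → λ' ≤ᵛ replicate n m → λ' +ᵛ delta n ≤ᵛ exponentBound n m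
λ+δ-bounded {n} {m = m} λ≤m =
  subst (_ ≤ᵛ_) (+ᵛ-comm (replicate n m) (replicate n (n ∸ 1))) (+ᵛ-mono-≤ᵛ λ≤m (delta-bounded n))

reflect-λ+δ : {λ' : Vec ℕ n} {m : ℕ} → λ' ≤ᵛ replicate n m →
              reflect (exponentBound n m) (λ' +ᵛ delta n) ≡ complement m λ' +ᵛ delta n
reflect-λ+δ {n} {λ'} {m} λ≤m = begin
  reflect (replicate n (n ∸ 1) +ᵛ replicate n m) (λ' +ᵛ delta n)
    ≡⟨ cong (λ c → reflect c (λ' +ᵛ delta n)) (+ᵛ-comm (replicate n (n ∸ 1)) (replicate n m)) ⟩
  reflect (replicate n m +ᵛ replicate n (n ∸ 1)) (λ' +ᵛ delta n)
    ≡⟨ reflect-+ᵛ λ≤m (delta-bounded n) ⟩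
  reflect (replicate n m) λ' +ᵛ reflect (replicate n (n ∸ 1)) (delta n)
    ≡⟨ cong₂ _+ᵛ_ (reflect-replicate m λ') (reflect-delta n) ⟩
  complement m λ' +ᵛ delta n ∎
  where open ≡-Reasoning

a-complement : {k m : ℕ} → k ≤ n → {λ' : Vec ℕ n} → λ' ≤ᵛ replicate n m →
               a (n ∸ k) m (complement m λ') ≡ a k m λ'
a-complement {n} {k} {m} k≤n {λ'} λ≤m = begin
  coeff (vandermonde n *P plethysm n (n ∸ k) m) (complement m λ' +ᵛ delta n)
    ≡⟨ cong (coeff (vandermonde n *P plethysm n (n ∸ k) m)) (reflect-λ+δ λ≤m) ⟨
  coeff (vandermonde n *P plethysm n (n ∸ k) m) (reflect (exponentBound n m) (λ' +ᵛ delta n))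
    ≡⟨ coeff-↭ _ (reflectP-vandermonde*plethysm k≤n m) ⟨
  coeff (reflectP (exponentBound n m) (vandermonde n *P plethysm n k m)) (reflect (exponentBound n m) (λ' +ᵛ delta n))
    ≡⟨ coeff-reflectP _ (vandermonde*plethysm-bounded n k m) (λ+δ-bounded λ≤m) ⟩
  coeff (vandermonde n *P plethysm n k m) (λ' +ᵛ delta n) ∎
  where open ≡-Reasoning

a-vanishes : (k m : ℕ) {λ' : Vec ℕ n} → m < first λ' → a k m λ' ≡ + 0
a-vanishes {zero}  k m {[]}     ()
a-vanishes {suc n} k m {x ∷ λ'} m<x = coeff-unbounded _ (vandermonde*plethysm-bounded (suc n) k m) exceeds
  where
  exceeds : ¬ ((x ∷ λ') +ᵛ delta (suc n) ≤ᵛ exponentBound (suc n) m)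
  exceeds (x+n≤n+m ∷ _) = ℕₚ.<⇒≱ m<x (ℕₚ.+-cancelˡ-≤ n x m (subst (_≤ n + m) (ℕₚ.+-comm x n) x+n≤n+m))

shiftedWithDegree : ℕ → Vec ℕ n → List (Subset n) → Bool
shiftedWithDegree k μ K = isShifted k K ∧ ⌊ ≡-dec ℕ._≟_ (degree K) μ ⌋

shiftedWithDegree-↭ : (k : ℕ) (μ : Vec ℕ n) {K L : List (Subset n)} → K ↭ L →
                      shiftedWithDegree k μ K ≡ shiftedWithDegree k μ L
shiftedWithDegree-↭ k μ K↭L =
  cong₂ _∧_ (isShifted-↭ k K↭L) (cong (λ d → ⌊ ≡-dec ℕ._≟_ d μ ⌋) (degree-↭ K↭L))

shiftedWithDegree-dual : {k m : ℕ} → k ≤ n → {λ' : Vec ℕ n} → λ' ≤ᵛ replicate n m → {K : List (Subset n)} →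
  length K ≡ m → shiftedWithDegree (n ∸ k) (complement m λ') (List.map dual K) ≡ shiftedWithDegree k λ' K
shiftedWithDegree-dual {n} {k} k≤n {λ'} λ≤m {K} refl =
  cong₂ _∧_ (isShifted-dual k≤n K) (⌊⌋-⇔ (mk⇔ to from) _ _)
  where
  to : degree (List.map dual K) ≡ complement (length K) λ' → degree K ≡ λ'
  to eq = reflect-injective (degree-bounded K) λ≤m
    (trans (sym (degree-dual K)) (trans eq (sym (reflect-replicate (length K) λ'))))
  from : degree K ≡ λ' → degree (List.map dual K) ≡ complement (length K) λ'
  from eq = trans (degree-dual K) (trans (cong (reflect (replicate n (length K))) eq) (reflect-replicate (length K) λ'))

a'-vanishes : (k m : ℕ) {λ' : Vec ℕ n} → m < first λ' → a' k m λ' ≡ 0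
a'-vanishes {zero}  k m {[]}     ()
a'-vanishes {suc n} k m {x ∷ λ'} m<x = cong length (Listₚ.filter-none (Bool.T? ∘ shiftedWithDegree k (x ∷ λ'))
  (All.map (λ {K} → not-counted K) (families-length (suc n) k m)))
  where
  not-counted : (K : List (Subset (suc n))) → length K ≡ m → ¬ T (shiftedWithDegree k (x ∷ λ') K)
  not-counted K refl counted =
    ℕₚ.<⇒≱ m<x (Pointwise.head (subst (_≤ᵛ replicate (suc n) (length K)) degree≡λ (degree-bounded K)))
    where
    degree≡λ : degree K ≡ x ∷ λ'
    degree≡λ = Dec.toWitness {a? = ≡-dec ℕ._≟_ (degree K) (x ∷ λ')} (proj₂ (Equivalence.to Boolₚ.T-∧ counted))

a'-complement : {k m : ℕ} → k ≤ n → {λ' : Vec ℕ n} → λ' ≤ᵛ replicate n m →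
                a' (n ∸ k) m (complement m λ') ≡ a' k m λ'
a'-complement {n} {k} {m} k≤n {λ'} λ≤m = begin
  length (filterᵇ (shiftedWithDegree (n ∸ k) (complement m λ')) (families n (n ∸ k) m))
    ≡⟨ Nestedₚ.xs↭ys⇒|xs|≡|ys| (Nestedₚ.filter⁺ (Bool.T? ∘ shiftedWithDegree (n ∸ k) (complement m λ'))
         (λ K↭L → subst T (shiftedWithDegree-↭ (n ∸ k) (complement m λ') K↭L)) (Nested.↭-sym (families-dual k≤n m))) ⟩
  length (filterᵇ (shiftedWithDegree (n ∸ k) (complement m λ')) (List.map (List.map dual) (families n k m)))
    ≡⟨ cong length (filterᵇ-map _ (shiftedWithDegree k λ') (List.map dual)
         (All.map (λ {K} → shiftedWithDegree-dual k≤n λ≤m {K}) (families-length n k m))) ⟩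
  length (List.map (List.map dual) (filterᵇ (shiftedWithDegree k λ') (families n k m)))
    ≡⟨ Listₚ.length-map (List.map dual) (filterᵇ (shiftedWithDegree k λ') (families n k m)) ⟩
  length (filterᵇ (shiftedWithDegree k λ') (families n k m)) ∎
  where open ≡-Reasoning

proposition5p8 : (k n : ℕ) → k ≤ n → (λ' : Vec ℕ n) → IsPartition λ' →
    (m : ℕ) → k * m ≡ sum λ' →
    ((m < first λ' → a k m λ' ≡ + 0) × (first λ' ≤ m → a (n ∸ k) m (complement m λ') ≡ a k m λ'))
    × ((m < first λ' → a' k m λ' ≡ 0) × (first λ' ≤ m → a' (n ∸ k) m (complement m λ') ≡ a' k m λ'))
proposition5p8 k n k≤n λ' decreasing m _ =
  (a-vanishes k m {λ'} , λ λ₁≤m → a-complement k≤n (partition-bounded decreasing m λ₁≤m)) ,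
  (a'-vanishes k m {λ'} , λ λ₁≤m → a'-complement k≤n (partition-bounded decreasing m λ₁≤m))
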